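{- With the convention $\mathrm{a}_{100,101}(0)=1$, we have $$\sum_{n\ge 0}\mathrm{a}_{100,101}(n)x^n=\frac{(1-x)^2-\sqrt{1-4x+2x^2+x^4}}{2x^2}$$ as formal power series. Equivalently, for every $n\ge 1$, the set $\mathcal{A}_{100,101}(n)$ is in bijection with the set of Dyck words of semilength $n$ avoiding $DDUU$.
   Context: An ascent of an integer word $x_1\cdots x_n$ is an index $j$ with $x_j<x_{j+1}$; $\mathrm{asc}(x_1\cdots x_n)$ denotes the number of ascents. An ascent sequence of length $n$ is a sequence $x_1\cdots x_n$ of nonnegative integers with $x_1=0$ and $x_i\le \mathrm{asc}(x_1\cdots x_{i-1})+1$ for all $1<i\le n$. A pattern is a word $p=p_1\cdots p_k$ of nonnegative integers whose set of values is $\{0,1,\dots,m\}$ for some $m$. A word $x_1\cdots x_n$ contains $p$ if there are indices $i_1<\cdots<i_k$ such that $x_{i_1}\cdots x_{i_k}$ is order-isomorphic to $p$ (i.e. for all $s,t$, $x_{i_s}<x_{i_t}$ iff $p_s<p_t$ and $x_{i_s}=x_{i_t}$ iff $p_s=p_t$); otherwise it avoids $p$. For a list $B$ of patterns, $\mathcal{A}_B(n)$ is the set of ascent sequences of length $n$ avoiding every pattern in $B$, and $\mathrm{a}_B(n)=|\mathcal{A}_B(n)|$. A Dyck word of semilength $n$ is a word in $\{U,D\}^{2n}$ with $n$ letters $U$ and $n$ letters $D$ such that every prefix has at least as many $U$s as $D$s. It avoids $DDUU$ if it has no four consecutive letters equal to $DDUU$. -}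

module Defs where

open import Data.Nat using (ℕ; zero; suc; _+_; _*_; _<_; _≤_; _<ᵇ_)
open import Data.Integer as ℤ using (ℤ)
open import Data.Fin using (Fin; toℕ)
open import Data.List using (List; []; _∷_; length; lookup; take; _++_)
open import Data.Bool using (if_then_else_)
open import Data.Product using (Σ; ∃; _×_; proj₁)
open import Data.Unit using (⊤)
open import Relation.Nullary using (¬_)
open import Relation.Binary.PropositionalEquality using (_≡_)
open import Function.Bundles using (_⇔_)

asc : List ℕ → ℕ
asc (x ∷ y ∷ r) = (if x <ᵇ y then 1 else 0) + asc (y ∷ r)
asc _           = 0

-- x₁ = 0 and x_i ≤ asc(x₁⋯x_{i-1}) + 1 for 1 < i ≤ n
-- (positions are 0-based Fin indices: position i here is x_{i+1})
IsAscentSeq : List ℕ → Set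
IsAscentSeq xs =
  ((i : Fin (length xs)) → toℕ i ≡ 0 → lookup xs i ≡ 0) ×
  ((i : Fin (length xs)) → 0 < toℕ i → lookup xs i ≤ suc (asc (take (toℕ i) xs)))

StrictlyIncreasing : {k m : ℕ} → (Fin k → Fin m) → Set
StrictlyIncreasing {k} ι = (s t : Fin k) → toℕ s < toℕ t → toℕ (ι s) < toℕ (ι t)

Contains : List ℕ → List ℕ → Set
Contains xs p =
  Σ (Fin (length p) → Fin (length xs)) λ ι →
    StrictlyIncreasing ι ×
    ((s t : Fin (length p)) →
       ((lookup xs (ι s) < lookup xs (ι t)) ⇔ (lookup p s < lookup p t)) ×
       ((lookup xs (ι s) ≡ lookup xs (ι t)) ⇔ (lookup p s ≡ lookup p t)))

Avoids : List ℕ → List ℕ → Set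
Avoids xs p = ¬ Contains xs p

p100 p101 : List ℕ
p100 = 1 ∷ 0 ∷ 0 ∷ []
p101 = 1 ∷ 0 ∷ 1 ∷ []

InA-100-101 : ℕ → List ℕ → Set
InA-100-101 n xs = (length xs ≡ n) × IsAscentSeq xs × Avoids xs p100 × Avoids xs p101

data Step : Set where
  U D : Step

countU countD : List Step → ℕ
countU []      = 0
countU (U ∷ w) = suc (countU w)
countU (D ∷ w) = countU w
countD []      = 0
countD (U ∷ w) = countD w
countD (D ∷ w) = suc (countD w)

IsDyck : ℕ → List Step → Set
IsDyck n w =
  (length w ≡ n + n) × (countU w ≡ n) × (countD w ≡ n) ×
  ((k : ℕ) → countD (take k w) ≤ countU (take k w))

AvoidsDDUU : List Step → Set
AvoidsDDUU w = ¬ (∃ λ u → ∃ λ v → w ≡ u ++ (D ∷ D ∷ U ∷ U ∷ []) ++ v)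

InDyckDDUU : ℕ → List Step → Set
InDyckDDUU n w = IsDyck n w × AvoidsDDUU w

record SubsetBij {A B : Set} (P : A → Set) (Q : B → Set) : Set where
  field
    to      : Σ A P → Σ B Q
    from    : Σ B Q → Σ A P
    from∘to : (a : Σ A P) → proj₁ (from (to a)) ≡ proj₁ a
    to∘from : (b : Σ B Q) → proj₁ (to (from b)) ≡ proj₁ b

HasCard : {A : Set} → (A → Set) → ℕ → Set
HasCard P k = SubsetBij P (λ (_ : Fin k) → ⊤)

Series : Set
Series = ℕ → ℤ

sumTo : (ℕ → ℤ) → ℕ → ℤ
sumTo f zero    = f 0
sumTo f (suc n) = sumTo f n ℤ.+ f (suc n)

_∸'_ : ℕ → ℕ → ℕ
m ∸' zero = m
zero ∸' suc n = zero
suc m ∸' suc n = m ∸' n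

_·_ : Series → Series → Series
(f · g) n = sumTo (λ i → f i ℤ.* g (n ∸' i)) n

_⊕_ _⊖_ : Series → Series → Series
(f ⊕ g) n = f n ℤ.+ g n
(f ⊖ g) n = f n ℤ.- g n

poly : List ℤ → Series
poly []       n       = ℤ.0ℤ
poly (c ∷ cs) zero    = c
poly (c ∷ cs) (suc n) = poly cs n

X : Series
X = poly (ℤ.0ℤ ∷ ℤ.1ℤ ∷ [])

ofℕ : (ℕ → ℕ) → Series
ofℕ f n = ℤ.+ (f n)

module Submission where

-- A letter is inverted by a word if it is a or b for some a occurring before b < a.  An
-- ascent sequence avoids 100 and 101 exactly when no letter is inverted by the letters
-- before it.  The letters of such a sequence so far are 0, …, asc, so the admissible next
-- letters are the letters not yet inverted together with asc + 1.  Recording each letter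
-- by its position c among these candidates is a bijection onto the sequences with c₁ = 0,
-- c_{i+1} ≤ c_i + 1, and c_{i+1} ≤ c_i after a descent c_i < c_{i-1}.  These are the
-- starting heights of the up steps of Dyck paths, the descent condition saying exactly
-- that no DD is followed by UU.  Cutting such a sequence 0 r before the first return of r
-- to 0 gives a_{n+1} = a_n + Σ_{i<n} a_{i+1} b_{n-1-i}, where b_0 = 1 and b_{j+1} = a_j;
-- that is, x²F² = (1-x)²F - (1-x), so S = (1-x)² - 2x²F satisfies
-- S² = (1-x)⁴ - 4x²(1-x) = 1 - 4x + 2x² + x⁴.

module Counting where

  open import Defs using (SubsetBij; HasCard)
  open import Data.Nat
  open import Data.Nat.Properties
  open import Data.Fin using (toℕ; fromℕ<)
  open import Data.Fin.Properties using (toℕ-fromℕ<; toℕ<n; toℕ-injective)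
  open import Data.Product using (_×_; _,_; proj₁; proj₂)
  open import Data.Sum using (_⊎_; inj₁; inj₂; [_,_]′)
  open import Data.Unit using (tt)
  open import Data.Empty using (⊥-elim)
  open import Relation.Nullary using (¬_; yes; no)
  open import Relation.Binary.PropositionalEquality
  open import Function.Base using (id)

  -- Unlike SubsetBij, the maps act on the whole carriers, so composition needs no proof irrelevance.
  record _≃_ {A B : Set} (P : A → Set) (Q : B → Set) : Set where
    field
      to        : A → B
      from      : B → A
      to-pres   : ∀ a → P a → Q (to a)
      from-pres : ∀ b → Q b → P (from b)
      from∘to   : ∀ a → P a → from (to a) ≡ a
      to∘from   : ∀ b → Q b → to (from b) ≡ b

  infix 4 _≃_
  open _≃_

  ≃-trans : {A B C : Set} {P : A → Set} {Q : B → Set} {R : C → Set} →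
            P ≃ Q → Q ≃ R → P ≃ R
  ≃-trans f g = record
    { to        = λ a → to g (to f a)
    ; from      = λ c → from f (from g c)
    ; to-pres   = λ a p → to-pres g _ (to-pres f a p)
    ; from-pres = λ c r → from-pres f _ (from-pres g c r)
    ; from∘to   = λ a p → trans (cong (from f) (from∘to g _ (to-pres f a p))) (from∘to f a p)
    ; to∘from   = λ c r → trans (cong (to g) (to∘from f _ (from-pres g c r))) (to∘from g c r)
    }

  ≃⇒SubsetBij : {A B : Set} {P : A → Set} {Q : B → Set} → P ≃ Q → SubsetBij P Q
  ≃⇒SubsetBij f = record
    { to      = λ (a , p) → to f a , to-pres f a p
    ; from    = λ (b , q) → from f b , from-pres f b q
    ; from∘to = λ (a , p) → from∘to f a p
    ; to∘from = λ (b , q) → to∘from f b q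
    }

  Card : {A : Set} → (A → Set) → ℕ → Set
  Card P k = P ≃ (_< k)

  Card⇒HasCard : {A : Set} {P : A → Set} {k : ℕ} → Card P k → HasCard P k
  Card⇒HasCard f = record
    { to      = λ (a , p) → fromℕ< (to-pres f a p) , tt
    ; from    = λ (i , _) → from f (toℕ i) , from-pres f (toℕ i) (toℕ<n i)
    ; from∘to = λ (a , p) → trans (cong (from f) (toℕ-fromℕ< (to-pres f a p))) (from∘to f a p)
    ; to∘from = λ (i , _) → toℕ-injective (trans (toℕ-fromℕ< _) (to∘from f (toℕ i) (toℕ<n i)))
    }

  Card-singleton : {A : Set} {P : A → Set} (a₀ : A) → P a₀ → (∀ a → P a → a ≡ a₀) → Card P 1
  Card-singleton a₀ p₀ unique = record
    { to        = λ _ → 0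
    ; from      = λ _ → a₀
    ; to-pres   = λ _ _ → s≤s z≤n
    ; from-pres = λ _ _ → p₀
    ; from∘to   = λ a p → sym (unique a p)
    ; to∘from   = λ { zero _ → refl ; (suc _) (s≤s ()) }
    }

  -- The carrier must be inhabited because `from` is total.
  Card-empty : {A : Set} {P : A → Set} → A → (∀ a → ¬ P a) → Card P 0
  Card-empty a₀ none = record
    { to        = λ _ → 0
    ; from      = λ _ → a₀
    ; to-pres   = λ a p → ⊥-elim (none a p)
    ; from-pres = λ _ ()
    ; from∘to   = λ a p → ⊥-elim (none a p)
    ; to∘from   = λ _ ()
    }

  Card-⊎ : {A B : Set} {P : A → Set} {Q : B → Set} {m k : ℕ} →
           Card P m → Card Q k → Card [ P , Q ]′ (m + k)
  Card-⊎ {P = P} {Q} {m} {k} f g = record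
    { to        = to⊎
    ; from      = from⊎
    ; to-pres   = λ { (inj₁ a) p → <-≤-trans (to-pres f a p) (m≤m+n m k)
                    ; (inj₂ b) q → +-monoʳ-< m (to-pres g b q) }
    ; from-pres = from⊎-pres
    ; from∘to   = from⊎∘to
    ; to∘from   = to∘from⊎
    }
    where
    to⊎ : _ ⊎ _ → ℕ
    to⊎ = [ to f , (λ b → m + to g b) ]′

    from⊎ : ℕ → _ ⊎ _
    from⊎ i with i <? m
    ... | yes _ = inj₁ (from f i)
    ... | no _  = inj₂ (from g (i ∸ m))

    ∸-bound : ∀ {i} → i < m + k → ¬ i < m → i ∸ m < k
    ∸-bound {i} i<m+k i≮m = subst (i ∸ m <_) (m+n∸m≡n m k) (∸-monoˡ-< i<m+k (≮⇒≥ i≮m))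

    from⊎-pres : ∀ i → i < m + k → [ P , Q ]′ (from⊎ i)
    from⊎-pres i i<m+k with i <? m
    ... | yes i<m = from-pres f i i<m
    ... | no i≮m  = from-pres g (i ∸ m) (∸-bound i<m+k i≮m)

    from⊎∘to : ∀ x → [ P , Q ]′ x → from⊎ (to⊎ x) ≡ x
    from⊎∘to (inj₁ a) p with to f a <? m
    ... | yes _ = cong inj₁ (from∘to f a p)
    ... | no ≮m = ⊥-elim (≮m (to-pres f a p))
    from⊎∘to (inj₂ b) q with m + to g b <? m
    ... | yes <m = ⊥-elim (m+n≮m m _ <m)
    ... | no _   = cong inj₂ (trans (cong (from g) (m+n∸m≡n m _)) (from∘to g b q))

    to∘from⊎ : ∀ i → i < m + k → to⊎ (from⊎ i) ≡ i
    to∘from⊎ i i<m+k with i <? m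
    ... | yes i<m = to∘from f i i<m
    ... | no i≮m  =
      trans (cong (m +_) (to∘from g (i ∸ m) (∸-bound i<m+k i≮m))) (m+[n∸m]≡n (≮⇒≥ i≮m))

  ∑< : ℕ → (ℕ → ℕ) → ℕ
  ∑< zero    f = 0
  ∑< (suc n) f = ∑< n f + f n

  infix 2 ∑<
  syntax ∑< n (λ i → e) = ∑[ i < n ] e

  ∑<-cong : ∀ n {f g : ℕ → ℕ} → (∀ i → i < n → f i ≡ g i) → ∑< n f ≡ ∑< n g
  ∑<-cong zero    f≡g = refl
  ∑<-cong (suc n) f≡g = cong₂ _+_ (∑<-cong n (λ i i<n → f≡g i (m<n⇒m<1+n i<n))) (f≡g n ≤-refl)

  ∑<-const : ∀ n k → (∑[ i < n ] k) ≡ n * k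
  ∑<-const zero    k = refl
  ∑<-const (suc n) k = trans (cong (_+ k) (∑<-const n k)) (+-comm (n * k) k)

  Union< : {X : Set} → ℕ → (ℕ → X → Set) → ℕ × X → Set
  Union< n P (i , x) = i < n × P i x

  Union<-suc : {X : Set} (n : ℕ) (P : ℕ → X → Set) → Union< (suc n) P ≃ [ Union< n P , P n ]′
  Union<-suc {X} n P = record
    { to        = split
    ; from      = [ id , (n ,_) ]′
    ; to-pres   = split-pres
    ; from-pres = λ { (inj₁ _) (i<n , p) → m<n⇒m<1+n i<n , p ; (inj₂ _) p → ≤-refl , p }
    ; from∘to   = from∘split
    ; to∘from   = split∘from
    }
    where
    split : ℕ × X → (ℕ × X) ⊎ X
    split (i , x) with i <? n
    ... | yes _ = inj₁ (i , x)
    ... | no _  = inj₂ x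

    split-pres : ∀ ix → Union< (suc n) P ix → [ Union< n P , P n ]′ (split ix)
    split-pres (i , x) (i<1+n , p) with i <? n
    ... | yes i<n = i<n , p
    ... | no i≮n  = subst (λ j → P j x) (≤-antisym (s≤s⁻¹ i<1+n) (≮⇒≥ i≮n)) p

    from∘split : ∀ ix → Union< (suc n) P ix → [ id , (n ,_) ]′ (split ix) ≡ ix
    from∘split (i , x) (i<1+n , _) with i <? n
    ... | yes _  = refl
    ... | no i≮n = cong (_, x) (≤-antisym (≮⇒≥ i≮n) (s≤s⁻¹ i<1+n))

    split∘from : ∀ y → [ Union< n P , P n ]′ y → split ([ id , (n ,_) ]′ y) ≡ y
    split∘from (inj₁ (i , x)) (i<n , _) with i <? n
    ... | yes _  = refl
    ... | no i≮n = ⊥-elim (i≮n i<n)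
    split∘from (inj₂ x) _ with n <? n
    ... | yes n<n = ⊥-elim (<-irrefl refl n<n)
    ... | no _    = refl

  Card-Union< : {X : Set} {P : ℕ → X → Set} (c : ℕ → ℕ) (n : ℕ) → X →
                (∀ i → i < n → Card (P i) (c i)) → Card (Union< n P) (∑[ i < n ] c i)
  Card-Union< c zero    x₀ _     = Card-empty (0 , x₀) (λ _ ())
  Card-Union< {P = P} c (suc n) x₀ cards =
    ≃-trans (Union<-suc n P)
      (Card-⊎ (Card-Union< c n x₀ (λ i i<n → cards i (m<n⇒m<1+n i<n))) (cards n ≤-refl))

  Card-× : {A B : Set} {P : A → Set} {Q : B → Set} {m k : ℕ} → B →
           Card P m → Card Q k → Card (λ (ab : A × B) → P (proj₁ ab) × Q (proj₂ ab)) (m * k)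
  Card-× {Q = Q} {m} {k} b₀ f g =
    ≃-trans index-first (subst (Card _) (∑<-const m k) (Card-Union< (λ _ → k) m b₀ (λ _ _ → g)))
    where
    index-first : _ ≃ Union< m (λ _ → Q)
    index-first = record
      { to        = λ (a , b) → to f a , b
      ; from      = λ (i , b) → from f i , b
      ; to-pres   = λ (a , _) (p , q) → to-pres f a p , q
      ; from-pres = λ (i , _) (i<m , q) → from-pres f i i<m , q
      ; from∘to   = λ (a , b) (p , _) → cong (_, b) (from∘to f a p)
      ; to∘from   = λ (i , b) (i<m , _) → cong (_, b) (to∘from f i i<m)
      }

module CSequences where

  open import Data.Nat using (ℕ; suc; _≤_; _<ᵇ_)
  open import Data.Bool using (Bool; true; false)
  open import Data.List using (List; []; _∷_; length)
  open import Data.Product using (_×_)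
  open import Data.Unit using (⊤)
  open import Relation.Binary.PropositionalEquality using (_≡_)

  bound : ℕ → Bool → ℕ
  bound p false = suc p
  bound p true  = p

  -- `CTail p d cs`: cs may follow an entry p; d records whether p ended a descent.
  CTail : ℕ → Bool → List ℕ → Set
  CTail p d []       = ⊤
  CTail p d (c ∷ cs) = c ≤ bound p d × CTail c (c <ᵇ p) cs

  IsCSeq : List ℕ → Set
  IsCSeq []       = ⊤
  IsCSeq (c ∷ cs) = c ≡ 0 × CTail 0 false cs

  CSeq : ℕ → List ℕ → Set
  CSeq n cs = length cs ≡ n × IsCSeq cs

module PatternAvoidance where

  open import Defs
  open import Data.Nat
  open import Data.Nat.Properties
  open import Data.Bool using (true; false; if_then_else_)
  open import Data.Bool.Properties using (T-≡)
  open import Data.Fin using (Fin; toℕ; zero; suc)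
  open import Data.List using (List; []; _∷_; length; _++_; take; lookup)
  open import Data.List.Properties using (++-assoc; ++-identityʳ)
  open import Data.List.Membership.Propositional using (_∈_)
  open import Data.List.Membership.Propositional.Properties using (∈-++⁺ˡ; ∈-++⁺ʳ; ∈-++⁻)
  open import Data.List.Relation.Unary.Any using (here; there)
  open import Data.Product using (∃-syntax; _×_; _,_; proj₁; proj₂)
  open import Data.Sum using (_⊎_; inj₁; inj₂; [_,_]′)
  open import Data.Unit using (⊤; tt)
  open import Data.Empty using (⊥-elim)
  open import Relation.Nullary using (¬_)
  open import Relation.Binary.PropositionalEquality
  open import Function.Base using (id)
  open import Function.Bundles using (_⇔_; mk⇔; Equivalence)

  data Inversion : List ℕ → ℕ → ℕ → Set where
    here  : ∀ {a b xs}   → b < a → b ∈ xs → Inversion (a ∷ xs) a b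
    there : ∀ {x a b xs} → Inversion xs a b → Inversion (x ∷ xs) a b

  -- Appending an inverted letter to p creates an occurrence of 100 or 101.
  Inverted : List ℕ → ℕ → Set
  Inverted p u = ∃[ v ] (Inversion p u v ⊎ Inversion p v u)

  AscentBound : List ℕ → ℕ → Set
  AscentBound []        v = v ≡ 0
  AscentBound p@(_ ∷ _) v = v ≤ suc (asc p)

  Admissible : List ℕ → ℕ → Set
  Admissible p v = AscentBound p v × ¬ Inverted p v

  EveryLetter : {A : Set} → (List A → A → Set) → List A → List A → Set
  EveryLetter Q p []      = ⊤
  EveryLetter Q p (v ∷ r) = Q p v × EveryLetter Q (p ++ v ∷ []) r

  AtEachPosition : {A : Set} → (List A → A → Set) → List A → List A → Set
  AtEachPosition Q p r = (i : Fin (length r)) → Q (p ++ take (toℕ i) r) (lookup r i)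

  EveryLetter⇒AtEachPosition : {A : Set} {Q : List A → A → Set} → ∀ p r →
                               EveryLetter Q p r → AtEachPosition Q p r
  EveryLetter⇒AtEachPosition {Q = Q} p (v ∷ r) (q , _)  zero    =
    subst (λ p′ → Q p′ v) (sym (++-identityʳ p)) q
  EveryLetter⇒AtEachPosition {Q = Q} p (v ∷ r) (_ , qs) (suc i) =
    subst (λ p′ → Q p′ (lookup r i)) (++-assoc p (v ∷ []) (take (toℕ i) r))
          (EveryLetter⇒AtEachPosition (p ++ v ∷ []) r qs i)

  AtEachPosition⇒EveryLetter : {A : Set} {Q : List A → A → Set} → ∀ p r →
                               AtEachPosition Q p r → EveryLetter Q p r
  AtEachPosition⇒EveryLetter         p []      _  = tt
  AtEachPosition⇒EveryLetter {Q = Q} p (v ∷ r) qs =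
    subst (λ p′ → Q p′ v) (++-identityʳ p) (qs zero) ,
    AtEachPosition⇒EveryLetter (p ++ v ∷ []) r (λ i →
      subst (λ p′ → Q p′ (lookup r i)) (sym (++-assoc p (v ∷ []) (take (toℕ i) r))) (qs (suc i)))

  IsAscentSeq⇒AscentBound : ∀ xs → IsAscentSeq xs → AtEachPosition AscentBound [] xs
  IsAscentSeq⇒AscentBound (x ∷ xs) (first , rest) zero    = first zero refl
  IsAscentSeq⇒AscentBound (x ∷ xs) (first , rest) (suc i) = rest (suc i) (s≤s z≤n)

  AscentBound⇒IsAscentSeq : ∀ xs → AtEachPosition AscentBound [] xs → IsAscentSeq xs
  AscentBound⇒IsAscentSeq []       _      = (λ ()) , (λ ())
  AscentBound⇒IsAscentSeq (x ∷ xs) bounds =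
    (λ { zero _ → bounds zero }) , (λ { (suc i) _ → bounds (suc i) })

  Inversion⇒< : ∀ {p a b} → Inversion p a b → b < a
  Inversion⇒< (here b<a _) = b<a
  Inversion⇒< (there inv)  = Inversion⇒< inv

  lookup∈take : ∀ (xs : List ℕ) (j : Fin (length xs)) k → toℕ j < k → lookup xs j ∈ take k xs
  lookup∈take (x ∷ xs) zero    (suc k) _         = here refl
  lookup∈take (x ∷ xs) (suc j) (suc k) (s≤s j<k) = there (lookup∈take xs j k j<k)

  Inversion-take : ∀ (xs : List ℕ) (i j : Fin (length xs)) k → toℕ i < toℕ j → toℕ j < k →
                   lookup xs j < lookup xs i → Inversion (take k xs) (lookup xs i) (lookup xs j)
  Inversion-take (x ∷ xs) zero    (suc j) (suc k) _         (s≤s j<k) xj<xi =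
    here xj<xi (lookup∈take xs j k j<k)
  Inversion-take (x ∷ xs) (suc i) (suc j) (suc k) (s≤s i<j) (s≤s j<k) xj<xi =
    there (Inversion-take xs i j k i<j j<k xj<xi)

  Inversion-take⁻ : ∀ (xs : List ℕ) k {a b} → Inversion (take k xs) a b →
                    ∃[ i ] ∃[ j ] (toℕ i < toℕ j × toℕ j < k × lookup xs i ≡ a × lookup xs j ≡ b)
  Inversion-take⁻ (x ∷ xs) (suc k) (here _ b∈) =
    let (j , j<k , xj≡b) = position xs k b∈ in zero , suc j , s≤s z≤n , s≤s j<k , refl , xj≡b
    where
    position : ∀ (xs : List ℕ) k {b} → b ∈ take k xs → ∃[ j ] (toℕ j < k × lookup xs j ≡ b)
    position (x ∷ xs) (suc k) (here b≡x) = zero , s≤s z≤n , sym b≡x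
    position (x ∷ xs) (suc k) (there b∈) =
      let (j , j<k , xj≡b) = position xs k b∈ in suc j , s≤s j<k , xj≡b
  Inversion-take⁻ (x ∷ xs) (suc k) (there inv) =
    let (i , j , i<j , j<k , xi≡a , xj≡b) = Inversion-take⁻ xs k inv
    in suc i , suc j , s≤s i<j , s≤s j<k , xi≡a , xj≡b

  realise : ℕ → ℕ → ℕ → ℕ
  realise a b zero    = b
  realise a b (suc _) = a

  realise-iso : ∀ {a b} → b < a → ∀ q r → q ≤ 1 → r ≤ 1 →
                ((realise a b q < realise a b r) ⇔ (q < r)) × ((realise a b q ≡ realise a b r) ⇔ (q ≡ r))
  realise-iso b<a zero zero _ _ =
    mk⇔ (λ b<b → ⊥-elim (<-irrefl refl b<b)) (λ ()) , mk⇔ (λ _ → refl) (λ _ → refl)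
  realise-iso b<a zero (suc zero) _ _ =
    mk⇔ (λ _ → s≤s z≤n) (λ _ → b<a) , mk⇔ (λ b≡a → ⊥-elim (<-irrefl b≡a b<a)) (λ ())
  realise-iso b<a (suc zero) zero _ _ =
    mk⇔ (λ a<b → ⊥-elim (<-asym a<b b<a)) (λ ()) , mk⇔ (λ a≡b → ⊥-elim (<-irrefl (sym a≡b) b<a)) (λ ())
  realise-iso b<a (suc zero) (suc zero) _ _ =
    mk⇔ (λ a<a → ⊥-elim (<-irrefl refl a<a)) (λ { (s≤s ()) }) , mk⇔ (λ _ → refl) (λ _ → refl)
  realise-iso b<a zero          (suc (suc _)) _        (s≤s ())
  realise-iso b<a (suc zero)    (suc (suc _)) _        (s≤s ())
  realise-iso b<a (suc (suc _)) _             (s≤s ()) _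

  realises⇒Contains : ∀ xs p (ι : Fin (length p) → Fin (length xs)) {a b} → StrictlyIncreasing ι → b < a →
                      (∀ s → lookup p s ≤ 1) → (∀ s → lookup xs (ι s) ≡ realise a b (lookup p s)) → Contains xs p
  realises⇒Contains xs p ι inc b<a p≤1 realised = ι , inc , λ s t →
    let (<-iso , ≡-iso) = realise-iso b<a (lookup p s) (lookup p t) (p≤1 s) (p≤1 t) in
    subst₂ (λ x y → (x < y) ⇔ (lookup p s < lookup p t)) (sym (realised s)) (sym (realised t)) <-iso ,
    subst₂ (λ x y → (x ≡ y) ⇔ (lookup p s ≡ lookup p t)) (sym (realised s)) (sym (realised t)) ≡-iso

  triple : ∀ {n} → Fin n → Fin n → Fin n → Fin 3 → Fin n
  triple i j k zero             = i
  triple i j k (suc zero)       = j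
  triple i j k (suc (suc zero)) = k

  triple-increasing : ∀ {n} (i j k : Fin n) → toℕ i < toℕ j → toℕ j < toℕ k → StrictlyIncreasing (triple i j k)
  triple-increasing i j k i<j j<k zero       (suc zero)       _ = i<j
  triple-increasing i j k i<j j<k zero       (suc (suc zero)) _ = <-trans i<j j<k
  triple-increasing i j k i<j j<k (suc zero) (suc (suc zero)) _ = j<k
  triple-increasing i j k i<j j<k zero             zero             ()
  triple-increasing i j k i<j j<k (suc zero)       zero             ()
  triple-increasing i j k i<j j<k (suc zero)       (suc zero)       (s≤s ())
  triple-increasing i j k i<j j<k (suc (suc zero)) zero             ()
  triple-increasing i j k i<j j<k (suc (suc zero)) (suc zero)       (s≤s ())
  triple-increasing i j k i<j j<k (suc (suc zero)) (suc (suc zero)) (s≤s (s≤s ()))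

  Contains-100 : ∀ xs (i j k : Fin (length xs)) → toℕ i < toℕ j → toℕ j < toℕ k →
                 lookup xs j < lookup xs i → lookup xs k ≡ lookup xs j → Contains xs p100
  Contains-100 xs i j k i<j j<k xj<xi xk≡xj =
    realises⇒Contains xs p100 (triple i j k) (triple-increasing i j k i<j j<k) xj<xi
      (λ { zero → ≤-refl ; (suc zero) → z≤n ; (suc (suc zero)) → z≤n })
      (λ { zero → refl ; (suc zero) → refl ; (suc (suc zero)) → xk≡xj })

  Contains-101 : ∀ xs (i j k : Fin (length xs)) → toℕ i < toℕ j → toℕ j < toℕ k →
                 lookup xs j < lookup xs i → lookup xs k ≡ lookup xs i → Contains xs p101
  Contains-101 xs i j k i<j j<k xj<xi xk≡xi =
    realises⇒Contains xs p101 (triple i j k) (triple-increasing i j k i<j j<k) xj<xi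
      (λ { zero → ≤-refl ; (suc zero) → z≤n ; (suc (suc zero)) → ≤-refl })
      (λ { zero → refl ; (suc zero) → refl ; (suc (suc zero)) → xk≡xi })

  Avoids⇒¬Inverted : ∀ xs → Avoids xs p100 → Avoids xs p101 → AtEachPosition (λ p v → ¬ Inverted p v) [] xs
  Avoids⇒¬Inverted xs avoid100 avoid101 k (v , inj₁ inv) =
    let (i , j , i<j , j<k , xi≡xk , xj≡v) = Inversion-take⁻ xs (toℕ k) inv
        xj<xi = subst₂ _<_ (sym xj≡v) (sym xi≡xk) (Inversion⇒< inv)
    in avoid101 (Contains-101 xs i j k i<j j<k xj<xi (sym xi≡xk))
  Avoids⇒¬Inverted xs avoid100 avoid101 k (v , inj₂ inv) =
    let (i , j , i<j , j<k , xi≡v , xj≡xk) = Inversion-take⁻ xs (toℕ k) inv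
        xj<xi = subst₂ _<_ (sym xj≡xk) (sym xi≡v) (Inversion⇒< inv)
    in avoid100 (Contains-100 xs i j k i<j j<k xj<xi (sym xj≡xk))

  occurrence-inversion : ∀ xs x → (occ : Contains xs (1 ∷ 0 ∷ x ∷ [])) →
                         let ι = proj₁ occ in
                         Inversion (take (toℕ (ι (suc (suc zero)))) xs) (lookup xs (ι zero)) (lookup xs (ι (suc zero)))
  occurrence-inversion xs x (ι , inc , iso) =
    Inversion-take xs (ι zero) (ι (suc zero)) _ (inc zero (suc zero) (s≤s z≤n))
      (inc (suc zero) (suc (suc zero)) (s≤s (s≤s z≤n))) (Equivalence.from (proj₁ (iso (suc zero) zero)) (s≤s z≤n))

  ¬Inverted⇒Avoids100 : ∀ xs → AtEachPosition (λ p v → ¬ Inverted p v) [] xs → Avoids xs p100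
  ¬Inverted⇒Avoids100 xs free occ@(ι , _ , iso) = free k (lookup xs i , inj₂ inversion)
    where
    i = ι zero
    j = ι (suc zero)
    k = ι (suc (suc zero))
    xk≡xj : lookup xs k ≡ lookup xs j
    xk≡xj = Equivalence.from (proj₂ (iso (suc (suc zero)) (suc zero))) refl
    inversion : Inversion (take (toℕ k) xs) (lookup xs i) (lookup xs k)
    inversion = subst (Inversion (take (toℕ k) xs) (lookup xs i)) (sym xk≡xj)
                      (occurrence-inversion xs 0 occ)

  ¬Inverted⇒Avoids101 : ∀ xs → AtEachPosition (λ p v → ¬ Inverted p v) [] xs → Avoids xs p101
  ¬Inverted⇒Avoids101 xs free occ@(ι , _ , iso) = free k (lookup xs j , inj₁ inversion)
    where
    j = ι (suc zero)
    k = ι (suc (suc zero))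
    xk≡xi : lookup xs k ≡ lookup xs (ι zero)
    xk≡xi = Equivalence.from (proj₂ (iso (suc (suc zero)) zero)) refl
    inversion : Inversion (take (toℕ k) xs) (lookup xs k) (lookup xs j)
    inversion = subst (λ a → Inversion (take (toℕ k) xs) a (lookup xs j)) (sym xk≡xi)
                      (occurrence-inversion xs 1 occ)

  InA⇒Admissible : ∀ n xs → InA-100-101 n xs → EveryLetter Admissible [] xs
  InA⇒Admissible n xs (_ , asc-seq , avoid100 , avoid101) = AtEachPosition⇒EveryLetter [] xs (λ k →
    IsAscentSeq⇒AscentBound xs asc-seq k , Avoids⇒¬Inverted xs avoid100 avoid101 k)

  Admissible⇒InA : ∀ n xs → length xs ≡ n → EveryLetter Admissible [] xs → InA-100-101 n xs
  Admissible⇒InA n xs len adm =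
    len , AscentBound⇒IsAscentSeq xs (λ k → proj₁ (letters k)) ,
    ¬Inverted⇒Avoids100 xs (λ k → proj₂ (letters k)) , ¬Inverted⇒Avoids101 xs (λ k → proj₂ (letters k))
    where letters = EveryLetter⇒AtEachPosition [] xs adm

  ∈-snoc⁻ : ∀ (p : List ℕ) {u v} → u ∈ p ++ v ∷ [] → u ∈ p ⊎ u ≡ v
  ∈-snoc⁻ p u∈ with ∈-++⁻ p u∈
  ... | inj₁ u∈p        = inj₁ u∈p
  ... | inj₂ (here u≡v) = inj₂ u≡v

  ∈-snoc : ∀ (p : List ℕ) v → v ∈ p ++ v ∷ []
  ∈-snoc p v = ∈-++⁺ʳ p (here refl)

  ∈-snoc-old : ∀ (p : List ℕ) {u v} → v ∈ p → u ∈ p ++ v ∷ [] → u ∈ p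
  ∈-snoc-old p v∈p u∈ = [ id , (λ { refl → v∈p }) ]′ (∈-snoc⁻ p u∈)

  Inversion⇒∈ : ∀ {p a b} → Inversion p a b → a ∈ p × b ∈ p
  Inversion⇒∈ (here _ b∈) = here refl , there b∈
  Inversion⇒∈ (there inv) = let (a∈ , b∈) = Inversion⇒∈ inv in there a∈ , there b∈

  Inverted⇒∈ : ∀ {p u} → Inverted p u → u ∈ p
  Inverted⇒∈ (_ , inj₁ inv) = proj₁ (Inversion⇒∈ inv)
  Inverted⇒∈ (_ , inj₂ inv) = proj₂ (Inversion⇒∈ inv)

  Inversion-++ : ∀ {p a b} q → Inversion p a b → Inversion (p ++ q) a b
  Inversion-++ q (here b<a b∈) = here b<a (∈-++⁺ˡ b∈)
  Inversion-++ q (there inv)   = there (Inversion-++ q inv)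

  Inverted-++ : ∀ {p u} q → Inverted p u → Inverted (p ++ q) u
  Inverted-++ q (v , inj₁ inv) = v , inj₁ (Inversion-++ q inv)
  Inverted-++ q (v , inj₂ inv) = v , inj₂ (Inversion-++ q inv)

  Inversion-snoc : ∀ p {a v} → a ∈ p → v < a → Inversion (p ++ v ∷ []) a v
  Inversion-snoc (x ∷ p) (here refl) v<a = here v<a (∈-snoc p _)
  Inversion-snoc (x ∷ p) (there a∈)  v<a = there (Inversion-snoc p a∈ v<a)

  Inversion-snoc⁻ : ∀ p {v a b} → Inversion (p ++ v ∷ []) a b → Inversion p a b ⊎ (a ∈ p × b ≡ v)
  Inversion-snoc⁻ []      (here _ ())
  Inversion-snoc⁻ []      (there ())
  Inversion-snoc⁻ (x ∷ p) (here b<a b∈) with ∈-snoc⁻ p b∈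
  ... | inj₁ b∈p = inj₁ (here b<a b∈p)
  ... | inj₂ b≡v = inj₂ (here refl , b≡v)
  Inversion-snoc⁻ (x ∷ p) (there inv) with Inversion-snoc⁻ p inv
  ... | inj₁ inv′       = inj₁ (there inv′)
  ... | inj₂ (a∈ , b≡v) = inj₂ (there a∈ , b≡v)

  Inverted-snoc⁻ : ∀ p {v u} → Inverted (p ++ v ∷ []) u →
                   Inverted p u ⊎ ∃[ a ] (a ∈ p × v < a × (u ≡ a ⊎ u ≡ v))
  Inverted-snoc⁻ p (w , inj₁ inv) with Inversion-snoc⁻ p inv
  ... | inj₁ inv′       = inj₁ (w , inj₁ inv′)
  ... | inj₂ (u∈ , refl) = inj₂ (_ , u∈ , Inversion⇒< inv , inj₁ refl)
  Inverted-snoc⁻ p (w , inj₂ inv) with Inversion-snoc⁻ p inv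
  ... | inj₁ inv′        = inj₁ (w , inj₂ inv′)
  ... | inj₂ (w∈ , refl) = inj₂ (w , w∈ , Inversion⇒< inv , inj₂ refl)

  Inverted-snoc-≥ : ∀ p {v u} → (∀ {a} → a ∈ p → a ≤ v) → Inverted (p ++ v ∷ []) u → Inverted p u
  Inverted-snoc-≥ p below inverted with Inverted-snoc⁻ p inverted
  ... | inj₁ inv                = inv
  ... | inj₂ (_ , a∈ , v<a , _) = ⊥-elim (<⇒≱ v<a (below a∈))

  -- An earlier letter above the repeated one was already above its first copy.
  Inverted-snoc-last : ∀ p′ {l u} → Inverted ((p′ ++ l ∷ []) ++ l ∷ []) u → Inverted (p′ ++ l ∷ []) u
  Inverted-snoc-last p′ {l} inverted with Inverted-snoc⁻ (p′ ++ l ∷ []) inverted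
  ... | inj₁ inv = inv
  ... | inj₂ (a , a∈ , l<a , u≡) with ∈-snoc⁻ p′ a∈
  ...   | inj₂ refl = ⊥-elim (<-irrefl refl l<a)
  ...   | inj₁ a∈p′ with u≡
  ...     | inj₁ refl = l , inj₁ (Inversion-snoc p′ a∈p′ l<a)
  ...     | inj₂ refl = a , inj₂ (Inversion-snoc p′ a∈p′ l<a)

  <⇒<ᵇ≡true : ∀ {m n} → m < n → (m <ᵇ n) ≡ true
  <⇒<ᵇ≡true m<n = Equivalence.to T-≡ (<⇒<ᵇ m<n)

  <ᵇ≡true⇒< : ∀ {m n} → (m <ᵇ n) ≡ true → m < n
  <ᵇ≡true⇒< {m} {n} eq = <ᵇ⇒< m n (Equivalence.from T-≡ eq)

  ≤⇒<ᵇ≡false : ∀ {m n} → n ≤ m → (m <ᵇ n) ≡ false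
  ≤⇒<ᵇ≡false {m} {n} n≤m with m <ᵇ n in eq
  ... | false = refl
  ... | true  = ⊥-elim (≤⇒≯ n≤m (<ᵇ≡true⇒< eq))

  ascent : ℕ → ℕ → ℕ
  ascent x y = if x <ᵇ y then 1 else 0

  asc-snoc : ∀ p l v → asc ((p ++ l ∷ []) ++ v ∷ []) ≡ asc (p ++ l ∷ []) + ascent l v
  asc-snoc []          l v = +-comm (ascent l v) 0
  asc-snoc (x ∷ [])    l v =
    trans (cong (ascent x l +_) (asc-snoc [] l v)) (sym (+-assoc (ascent x l) 0 (ascent l v)))
  asc-snoc (x ∷ y ∷ p) l v =
    trans (cong (ascent x y +_) (asc-snoc (y ∷ p) l v))
          (sym (+-assoc (ascent x y) (asc (y ∷ p ++ l ∷ [])) (ascent l v)))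

  ascent-up : ∀ {l v} → l < v → ascent l v ≡ 1
  ascent-up l<v = cong (λ b → if b then 1 else 0) (<⇒<ᵇ≡true l<v)

  ascent-flat : ∀ {l v} → v ≤ l → ascent l v ≡ 0
  ascent-flat v≤l = cong (λ b → if b then 1 else 0) (≤⇒<ᵇ≡false v≤l)

  AscentBound-snoc : ∀ p l {v} → AscentBound (p ++ l ∷ []) v ⇔ (v ≤ suc (asc (p ++ l ∷ [])))
  AscentBound-snoc []      l = mk⇔ id id
  AscentBound-snoc (x ∷ p) l = mk⇔ id id

module ListPositions where

  open import Data.Nat
  open import Data.Nat.Properties
  open import Data.List using (List; []; _∷_; length; _++_; take)
  open import Data.List.Membership.Propositional using (_∈_)
  open import Data.List.Relation.Unary.Any using (here; there)
  open import Data.List.Relation.Unary.All as All using ()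
  open import Data.List.Relation.Unary.AllPairs using (AllPairs; _∷_)
  open import Data.Product using (_×_; _,_)
  open import Data.Empty using (⊥-elim)
  open import Relation.Nullary using (yes; no)
  open import Relation.Binary.PropositionalEquality

  nth : List ℕ → ℕ → ℕ
  nth []       _       = 0
  nth (x ∷ xs) zero    = x
  nth (x ∷ xs) (suc c) = nth xs c

  indexOf : ℕ → List ℕ → ℕ
  indexOf v []       = 0
  indexOf v (x ∷ xs) with v ≟ x
  ... | yes _ = 0
  ... | no _  = suc (indexOf v xs)

  nth-∈ : ∀ xs {c} → c < length xs → nth xs c ∈ xs
  nth-∈ (x ∷ xs) {zero}  _         = here refl
  nth-∈ (x ∷ xs) {suc c} (s≤s c<n) = there (nth-∈ xs c<n)

  nth-++ : ∀ xs ys {c} → c < length xs → nth (xs ++ ys) c ≡ nth xs c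
  nth-++ (x ∷ xs) ys {zero}  _         = refl
  nth-++ (x ∷ xs) ys {suc c} (s≤s c<n) = nth-++ xs ys c<n

  nth-snoc : ∀ xs y → nth (xs ++ y ∷ []) (length xs) ≡ y
  nth-snoc []       y = refl
  nth-snoc (x ∷ xs) y = nth-snoc xs y

  indexOf-∈ : ∀ {v} xs → v ∈ xs → nth xs (indexOf v xs) ≡ v × indexOf v xs < length xs
  indexOf-∈ {v} (x ∷ xs) v∈ with v ≟ x | v∈
  ... | yes v≡x | _          = sym v≡x , s≤s z≤n
  ... | no v≢x  | here v≡x   = ⊥-elim (v≢x v≡x)
  ... | no _    | there v∈xs = let (nth≡v , i<n) = indexOf-∈ xs v∈xs in nth≡v , s≤s i<n

  indexOf-nth : ∀ xs {c} → AllPairs _<_ xs → c < length xs → indexOf (nth xs c) xs ≡ c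
  indexOf-nth (x ∷ xs) {zero}  _            _         with x ≟ x
  ... | yes _   = refl
  ... | no x≢x  = ⊥-elim (x≢x refl)
  indexOf-nth (x ∷ xs) {suc c} (x< ∷ incr) (s≤s c<n) with nth xs c ≟ x
  ... | yes nth≡x = ⊥-elim (<-irrefl (sym nth≡x) (All.lookup x< (nth-∈ xs c<n)))
  ... | no _      = cong suc (indexOf-nth xs incr c<n)

  nth-mono : ∀ xs {i j} → AllPairs _<_ xs → i < j → j < length xs → nth xs i < nth xs j
  nth-mono (x ∷ xs) {zero}  {suc j} (x< ∷ _)    _         (s≤s j<n) = All.lookup x< (nth-∈ xs j<n)
  nth-mono (x ∷ xs) {suc i} {suc j} (_ ∷ incr) (s≤s i<j) (s≤s j<n) = nth-mono xs incr i<j j<n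

  ∈-take⇒ : ∀ xs {c u} → AllPairs _<_ xs → c < length xs → u ∈ take c xs → u ∈ xs × u < nth xs c
  ∈-take⇒ (x ∷ xs) {suc c} (x< ∷ _)    (s≤s c<n) (here refl) = here refl , All.lookup x< (nth-∈ xs c<n)
  ∈-take⇒ (x ∷ xs) {suc c} (_ ∷ incr) (s≤s c<n) (there u∈)  =
    let (u∈xs , u<) = ∈-take⇒ xs incr c<n u∈ in there u∈xs , u<

  ∈-take⇐ : ∀ xs {c u} → AllPairs _<_ xs → c < length xs → u ∈ xs → u < nth xs c → u ∈ take c xs
  ∈-take⇐ (x ∷ xs) {zero}  _           _         (here refl) u<x = ⊥-elim (<-irrefl refl u<x)
  ∈-take⇐ (x ∷ xs) {zero}  (x< ∷ _)    _         (there u∈)  u<x = ⊥-elim (<-asym u<x (All.lookup x< u∈))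
  ∈-take⇐ (x ∷ xs) {suc c} _           _         (here refl) _   = here refl
  ∈-take⇐ (x ∷ xs) {suc c} (_ ∷ incr) (s≤s c<n) (there u∈)  u<  = there (∈-take⇐ xs incr c<n u∈ u<)

module ActiveLetters where

  open import Defs
  open PatternAvoidance
  open ListPositions
  open CSequences
  open Counting using (_≃_)
  open import Data.Nat
  open import Data.Nat.Properties
  open import Data.Bool using (Bool; true; false)
  open import Data.List using (List; []; _∷_; length; _++_; take)
  open import Data.List.Properties using (length-++; length-take)
  open import Data.List.Membership.Propositional using (_∈_; _∉_)
  open import Data.List.Membership.Propositional.Properties using (∈-++⁺ˡ)
  open import Data.List.Relation.Unary.Any using (here)
  open import Data.List.Relation.Unary.All as All using (All; []; _∷_)
  open import Data.List.Relation.Unary.AllPairs as AllPairs using (AllPairs; []; _∷_)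
  import Data.List.Relation.Unary.AllPairs.Properties as AllPairs
  open import Data.Product using (∃-syntax; _×_; _,_; proj₁; proj₂)
  open import Data.Sum using (inj₁; inj₂; [_,_]′)
  open import Data.Unit using (tt)
  open import Data.Empty using (⊥-elim)
  open import Relation.Nullary using (¬_; yes; no)
  open import Relation.Binary.PropositionalEquality
  open import Relation.Binary.Definitions using (tri<; tri≈; tri>)
  open import Function.Base using (_∘_)
  open import Function.Bundles using (Equivalence)

  -- `active` lists, increasingly, the letters not yet inverted; the next letter is one of
  -- them or the new maximum `top + 1`, and is encoded by its position among these candidates.
  -- `pos` is that position for the last letter and `fell` records whether it decreased.
  record State : Set where
    constructor state
    field
      active : List ℕ
      top    : ℕ
      last   : ℕ
      pos    : ℕ
      fell   : Bool

  open State

  candidates : State → List ℕ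
  candidates s = active s ++ suc (top s) ∷ []

  bound-≥ : ∀ p d → p ≤ bound p d
  bound-≥ p false = n≤1+n p
  bound-≥ p true  = ≤-refl

  false≢true : false ≢ true
  false≢true ()

  retreat : List ℕ → ℕ → ℕ → Bool → State
  retreat A m c true  = state (take c A) m (nth A c) c true
  retreat A m c false = state A m (nth A c) c false

  next : State → ℕ → State
  next (state A m l cp fl) c with c ≟ length A
  ... | yes _ = state (A ++ suc m ∷ []) (suc m) (suc m) c (c <ᵇ cp)
  ... | no _  = retreat A m c (c <ᵇ cp)

  retreat-pos : ∀ A m c d → pos (retreat A m c d) ≡ c
  retreat-pos A m c true  = refl
  retreat-pos A m c false = refl

  retreat-fell : ∀ A m c d → fell (retreat A m c d) ≡ d
  retreat-fell A m c true  = refl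
  retreat-fell A m c false = refl

  next-pos : ∀ s c → pos (next s c) ≡ c
  next-pos (state A m l cp fl) c with c ≟ length A
  ... | yes _ = refl
  ... | no _  = retreat-pos A m c (c <ᵇ cp)

  next-fell : ∀ s c → fell (next s c) ≡ (c <ᵇ pos s)
  next-fell (state A m l cp fl) c with c ≟ length A
  ... | yes _ = refl
  ... | no _  = retreat-fell A m c (c <ᵇ cp)

  record Invariant (p : List ℕ) (s : State) : Set where
    field
      ends-with-last : ∃[ p′ ] p ≡ p′ ++ last s ∷ []
      asc≡top        : asc p ≡ top s
      ∈⇒≤top         : ∀ {u} → u ∈ p → u ≤ top s
      ≤top⇒∈         : ∀ {u} → u ≤ top s → u ∈ p
      active⇒        : ∀ {u} → u ∈ active s → u ∈ p × ¬ Inverted p u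
      active⇐        : ∀ {u} → u ∈ p → ¬ Inverted p u → u ∈ active s
      increasing     : AllPairs _<_ (active s)
      length-active  : length (active s) ≡ bound (pos s) (fell s)
      last-active    : fell s ≡ false → nth (active s) (pos s) ≡ last s
      above-active   : fell s ≡ true → All (_< last s) (active s)

  open Invariant

  candidates-increasing : ∀ {p s} → Invariant p s → AllPairs _<_ (candidates s)
  candidates-increasing I =
    AllPairs.++⁺ (increasing I) ([] ∷ [])
                 (All.tabulate (λ a∈ → s≤s (∈⇒≤top I (proj₁ (active⇒ I a∈))) ∷ []))

  length-candidates : ∀ {p s} → Invariant p s → length (candidates s) ≡ suc (bound (pos s) (fell s))
  length-candidates {s = s} I =
    trans (length-++ (active s)) (trans (+-comm _ 1) (cong suc (length-active I)))

  AscentBound⇒≤top+1 : ∀ {p s v} → Invariant p s → AscentBound p v → v ≤ suc (top s)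
  AscentBound⇒≤top+1 {v = v} I bounded with ends-with-last I
  ... | p′ , refl = subst (v ≤_) (cong suc (asc≡top I)) (Equivalence.to (AscentBound-snoc p′ _) bounded)

  ≤top+1⇒AscentBound : ∀ {p s v} → Invariant p s → v ≤ suc (top s) → AscentBound p v
  ≤top+1⇒AscentBound {v = v} I v≤ with ends-with-last I
  ... | p′ , refl = Equivalence.from (AscentBound-snoc p′ _) (subst (v ≤_) (cong suc (sym (asc≡top I))) v≤)

  top+1∉ : ∀ {p s} → Invariant p s → suc (top s) ∉ p
  top+1∉ I top∈ = <-irrefl refl (∈⇒≤top I top∈)

  Admissible⇒∈candidates : ∀ {p s v} → Invariant p s → Admissible p v → v ∈ candidates s
  Admissible⇒∈candidates {s = s} I (bounded , free) with m≤n⇒m<n∨m≡n (AscentBound⇒≤top+1 I bounded)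
  ... | inj₁ v≤top = ∈-++⁺ˡ (active⇐ I (≤top⇒∈ I (s≤s⁻¹ v≤top)) free)
  ... | inj₂ refl  = ∈-snoc (active s) _

  ∈candidates⇒Admissible : ∀ {p s v} → Invariant p s → v ∈ candidates s → Admissible p v
  ∈candidates⇒Admissible {s = s} I v∈ with ∈-snoc⁻ (active s) v∈
  ... | inj₁ v∈A  =
    ≤top+1⇒AscentBound I (m≤n⇒m≤1+n (∈⇒≤top I (proj₁ (active⇒ I v∈A)))) , proj₂ (active⇒ I v∈A)
  ... | inj₂ refl = ≤top+1⇒AscentBound I ≤-refl , top+1∉ I ∘ Inverted⇒∈

  Invariant-up : ∀ {p A m l cp fl} → Invariant p (state A m l cp fl) →
                 Invariant (p ++ suc m ∷ []) (state (A ++ suc m ∷ []) (suc m) (suc m) (length A) (length A <ᵇ cp))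
  Invariant-up {p} {A} {m} {l} {cp} {fl} I with ends-with-last I
  ... | p′ , refl = record
    { ends-with-last = p , refl
    ; asc≡top        = trans (asc-snoc p′ l (suc m))
                             (trans (cong₂ _+_ (asc≡top I) (ascent-up (s≤s (∈⇒≤top I (∈-snoc p′ l))))) (+-comm m 1))
    ; ∈⇒≤top         = λ u∈ → [ m≤n⇒m≤1+n ∘ ∈⇒≤top I , ≤-reflexive ]′ (∈-snoc⁻ p u∈)
    ; ≤top⇒∈         = λ u≤ → [ ∈-++⁺ˡ ∘ ≤top⇒∈ I ∘ s≤s⁻¹ , (λ { refl → ∈-snoc p _ }) ]′ (m≤n⇒m<n∨m≡n u≤)
    ; active⇒        = active⇒′
    ; active⇐        = active⇐′
    ; increasing     = candidates-increasing I
    ; length-active  = trans (length-++ A) (trans (+-comm (length A) 1) (cong (bound (length A)) (sym rose)))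
    ; last-active    = λ _ → nth-snoc A (suc m)
    ; above-active   = λ fell → ⊥-elim (false≢true (trans (sym rose) fell))
    }
    where
    rose : (length A <ᵇ cp) ≡ false
    rose = ≤⇒<ᵇ≡false (subst (cp ≤_) (sym (length-active I)) (bound-≥ cp fl))
    no-new : ∀ {u} → Inverted (p ++ suc m ∷ []) u → Inverted p u
    no-new = Inverted-snoc-≥ p (m≤n⇒m≤1+n ∘ ∈⇒≤top I)
    active⇒′ : ∀ {u} → u ∈ A ++ suc m ∷ [] → u ∈ p ++ suc m ∷ [] × ¬ Inverted (p ++ suc m ∷ []) u
    active⇒′ u∈ with ∈-snoc⁻ A u∈
    ... | inj₁ u∈A  = ∈-++⁺ˡ (proj₁ (active⇒ I u∈A)) , proj₂ (active⇒ I u∈A) ∘ no-new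
    ... | inj₂ refl = ∈-snoc p _ , top+1∉ I ∘ Inverted⇒∈ ∘ no-new
    active⇐′ : ∀ {u} → u ∈ p ++ suc m ∷ [] → ¬ Inverted (p ++ suc m ∷ []) u → u ∈ A ++ suc m ∷ []
    active⇐′ u∈ free with ∈-snoc⁻ p u∈
    ... | inj₁ u∈p  = ∈-++⁺ˡ (active⇐ I u∈p (free ∘ Inverted-++ _))
    ... | inj₂ refl = ∈-snoc A _

  Invariant-stay : ∀ {p A m l cp} → Invariant p (state A m l cp false) →
                   Invariant (p ++ l ∷ []) (state A m l cp false)
  Invariant-stay {p} {A} {m} {l} {cp} I with ends-with-last I
  ... | p′ , refl = record
    { ends-with-last = p , refl
    ; asc≡top        = trans (asc-snoc p′ l l)
                             (trans (cong₂ _+_ (asc≡top I) (ascent-flat (≤-refl {l}))) (+-identityʳ m))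
    ; ∈⇒≤top         = ∈⇒≤top I ∘ ∈-snoc-old p (∈-snoc p′ l)
    ; ≤top⇒∈         = ∈-++⁺ˡ ∘ ≤top⇒∈ I
    ; active⇒        = λ u∈ → ∈-++⁺ˡ (proj₁ (active⇒ I u∈)) , proj₂ (active⇒ I u∈) ∘ Inverted-snoc-last p′
    ; active⇐        = λ u∈ free → active⇐ I (∈-snoc-old p (∈-snoc p′ l) u∈) (free ∘ Inverted-++ _)
    ; increasing     = increasing I
    ; length-active  = length-active I
    ; last-active    = last-active I
    ; above-active   = λ ()
    }

  Invariant-down : ∀ {p A m l cp fl c} → Invariant p (state A m l cp fl) → c < length A → nth A c < l →
                   Invariant (p ++ nth A c ∷ []) (state (take c A) m (nth A c) c true)
  Invariant-down {p} {A} {m} {l} {cp} {fl} {c} I c<A v<l with ends-with-last I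
  ... | p′ , refl = record
    { ends-with-last = p , refl
    ; asc≡top        = trans (asc-snoc p′ l v)
                             (trans (cong₂ _+_ (asc≡top I) (ascent-flat (<⇒≤ v<l))) (+-identityʳ m))
    ; ∈⇒≤top         = ∈⇒≤top I ∘ ∈-snoc-old p v∈p
    ; ≤top⇒∈         = ∈-++⁺ˡ ∘ ≤top⇒∈ I
    ; active⇒        = active⇒′
    ; active⇐        = active⇐′
    ; increasing     = AllPairs.take⁺ c (increasing I)
    ; length-active  = trans (length-take c A) (m≤n⇒m⊓n≡m (<⇒≤ c<A))
    ; last-active    = λ ()
    ; above-active   = λ _ → All.tabulate (λ u∈ → proj₂ (∈-take⇒ A (increasing I) c<A u∈))
    }
    where
    v = nth A c
    v∈p : v ∈ p
    v∈p = proj₁ (active⇒ I (nth-∈ A c<A))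

    active⇒′ : ∀ {u} → u ∈ take c A → u ∈ p ++ v ∷ [] × ¬ Inverted (p ++ v ∷ []) u
    active⇒′ u∈ = ∈-++⁺ˡ (proj₁ (active⇒ I u∈A)) , still-free
      where
      u∈A = proj₁ (∈-take⇒ A (increasing I) c<A u∈)
      u<v = proj₂ (∈-take⇒ A (increasing I) c<A u∈)
      still-free : ¬ Inverted (p ++ v ∷ []) _
      still-free inverted with Inverted-snoc⁻ p inverted
      ... | inj₁ inv                       = proj₂ (active⇒ I u∈A) inv
      ... | inj₂ (_ , _ , v<a , inj₁ refl) = <-asym u<v v<a
      ... | inj₂ (_ , _ , _   , inj₂ refl) = <-irrefl refl u<v

    active⇐′ : ∀ {u} → u ∈ p ++ v ∷ [] → ¬ Inverted (p ++ v ∷ []) u → u ∈ take c A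
    active⇐′ {u} u∈ free with <-cmp u v
    ... | tri< u<v _ _ = ∈-take⇐ A (increasing I) c<A (active⇐ I (∈-snoc-old p v∈p u∈) (free ∘ Inverted-++ _)) u<v
    ... | tri≈ _ refl _ = ⊥-elim (free (l , inj₂ (Inversion-snoc p (∈-snoc p′ l) v<l)))
    ... | tri> _ _ v<u = ⊥-elim (free (v , inj₁ (Inversion-snoc p (∈-snoc-old p v∈p u∈) v<u)))

  earlier-below-last : ∀ {p A m l cp fl c} → Invariant p (state A m l cp fl) → c < cp → nth A c < l
  earlier-below-last {A = A} {fl = true}  I c<cp =
    All.lookup (above-active I refl) (nth-∈ A (subst (_ <_) (sym (length-active I)) c<cp))
  earlier-below-last {A = A} {cp = cp} {fl = false} I c<cp =
    subst (nth A _ <_) (last-active I refl)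
          (nth-mono A (increasing I) c<cp (subst (cp <_) (sym (length-active I)) ≤-refl))

  stay-position : ∀ {p A m l cp fl c} → Invariant p (state A m l cp fl) → c < length A → ¬ c < cp →
                  fl ≡ false × c ≡ cp
  stay-position {fl = true}  I c<A c≮cp = ⊥-elim (c≮cp (subst (_ <_) (length-active I) c<A))
  stay-position {fl = false} I c<A c≮cp =
    refl , ≤-antisym (s≤s⁻¹ (subst (_ <_) (length-active I) c<A)) (≮⇒≥ c≮cp)

  old-candidate : ∀ (A : List ℕ) x {c} → c < length (A ++ x ∷ []) → c ≢ length A → c < length A
  old-candidate A x c<len c≢A =
    ≤∧≢⇒< (s≤s⁻¹ (subst (_ <_) (trans (length-++ A) (+-comm (length A) 1)) c<len)) c≢A

  Invariant-retreat : ∀ {p A m l cp fl c} → Invariant p (state A m l cp fl) → c < length A →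
                      ∀ d → (c <ᵇ cp) ≡ d → Invariant (p ++ nth A c ∷ []) (retreat A m c d)
  Invariant-retreat I c<A true  c<cp = Invariant-down I c<A (earlier-below-last I (<ᵇ≡true⇒< c<cp))
  Invariant-retreat {p} {A} {m} I c<A false c≮cp
    with stay-position I c<A (λ c<cp → false≢true (trans (sym c≮cp) (<⇒<ᵇ≡true c<cp)))
  ... | refl , refl =
    subst (λ v → Invariant (p ++ v ∷ []) (state A m v _ false)) (sym (last-active I refl)) (Invariant-stay I)

  Invariant-next : ∀ {p s c} → Invariant p s → c < length (candidates s) →
                   Invariant (p ++ nth (candidates s) c ∷ []) (next s c)
  Invariant-next {p} {state A m l cp fl} {c} I c<len with c ≟ length A
  ... | yes refl = subst (λ v → Invariant (p ++ v ∷ []) (state (A ++ suc m ∷ []) (suc m) (suc m) c (c <ᵇ cp)))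
                         (sym (nth-snoc A (suc m))) (Invariant-up I)
  ... | no c≢A   = subst (λ v → Invariant (p ++ v ∷ []) (retreat A m c (c <ᵇ cp)))
                         (sym (nth-++ A (suc m ∷ []) c<A)) (Invariant-retreat I c<A (c <ᵇ cp) refl)
    where c<A = old-candidate A (suc m) c<len c≢A

  encode : State → List ℕ → List ℕ
  encode s []      = []
  encode s (v ∷ r) = indexOf v (candidates s) ∷ encode (next s (indexOf v (candidates s))) r

  decode : State → List ℕ → List ℕ
  decode s []       = []
  decode s (c ∷ cs) = nth (candidates s) c ∷ decode (next s c) cs

  length-encode : ∀ s r → length (encode s r) ≡ length r
  length-encode s []      = refl
  length-encode s (v ∷ r) = cong suc (length-encode _ r)

  length-decode : ∀ s cs → length (decode s cs) ≡ length cs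
  length-decode s []       = refl
  length-decode s (c ∷ cs) = cong suc (length-decode _ cs)

  <candidates⇒≤bound : ∀ {p s c} → Invariant p s → c < length (candidates s) → c ≤ bound (pos s) (fell s)
  <candidates⇒≤bound I c<len = s≤s⁻¹ (subst (_ <_) (length-candidates I) c<len)

  encode-correct : ∀ {p s} r → Invariant p s → EveryLetter Admissible p r →
                   CTail (pos s) (fell s) (encode s r) × decode s (encode s r) ≡ r
  encode-correct []      _ _ = tt , refl
  encode-correct {p} {s} (v ∷ r) I (adm , rest) =
    (<candidates⇒≤bound I c<len ,
     subst₂ (λ p d → CTail p d (encode (next s c) r)) (next-pos s c) (next-fell s c) (proj₁ IH)) ,
    cong₂ _∷_ nth≡v (proj₂ IH)
    where
    C = candidates s
    c = indexOf v C
    nth≡v = proj₁ (indexOf-∈ C (Admissible⇒∈candidates I adm))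
    c<len = proj₂ (indexOf-∈ C (Admissible⇒∈candidates I adm))
    I′ : Invariant (p ++ v ∷ []) (next s c)
    I′ = subst (λ x → Invariant (p ++ x ∷ []) (next s c)) nth≡v (Invariant-next I c<len)
    IH = encode-correct r I′ rest

  decode-correct : ∀ {p s} cs → Invariant p s → CTail (pos s) (fell s) cs →
                   EveryLetter Admissible p (decode s cs) × encode s (decode s cs) ≡ cs
  decode-correct []       _ _ = tt , refl
  decode-correct {p} {s} (c ∷ cs) I (c≤b , tl) =
    (∈candidates⇒Admissible I (nth-∈ C c<len) , proj₁ IH) ,
    trans (cong (λ i → i ∷ encode (next s i) (decode (next s c) cs)) index≡c) (cong (c ∷_) (proj₂ IH))
    where
    C = candidates s
    c<len : c < length C
    c<len = subst (c <_) (sym (length-candidates I)) (s≤s c≤b)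
    index≡c : indexOf (nth C c) C ≡ c
    index≡c = indexOf-nth C (candidates-increasing I) c<len
    IH = decode-correct cs (Invariant-next I c<len)
                            (subst₂ (λ p d → CTail p d cs) (sym (next-pos s c)) (sym (next-fell s c)) tl)

  initial : State
  initial = state (0 ∷ []) 0 0 0 false

  ¬Inverted-singleton : ∀ x {u} → ¬ Inverted (x ∷ []) u
  ¬Inverted-singleton x (_ , inj₁ (here _ ()))
  ¬Inverted-singleton x (_ , inj₁ (there ()))
  ¬Inverted-singleton x (_ , inj₂ (here _ ()))
  ¬Inverted-singleton x (_ , inj₂ (there ()))

  Invariant-initial : Invariant (0 ∷ []) initial
  Invariant-initial = record
    { ends-with-last = [] , refl
    ; asc≡top        = refl
    ; ∈⇒≤top         = λ { (here refl) → z≤n }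
    ; ≤top⇒∈         = λ { z≤n → here refl }
    ; active⇒        = λ { (here refl) → here refl , ¬Inverted-singleton 0 }
    ; active⇐        = λ { (here refl) _ → here refl }
    ; increasing     = [] ∷ []
    ; length-active  = refl
    ; last-active    = λ _ → refl
    ; above-active   = λ ()
    }

  toCSeq : List ℕ → List ℕ
  toCSeq []      = []
  toCSeq (_ ∷ r) = 0 ∷ encode initial r

  fromCSeq : List ℕ → List ℕ
  fromCSeq []       = []
  fromCSeq (_ ∷ cs) = 0 ∷ decode initial cs

  InA≃CSeq : ∀ n → InA-100-101 n ≃ CSeq n
  InA≃CSeq n = record
    { to        = toCSeq
    ; from      = fromCSeq
    ; to-pres   = λ xs inA → to-pres xs (proj₁ inA) (InA⇒Admissible n xs inA)
    ; from-pres = from-pres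
    ; from∘to   = λ xs inA → from∘to xs (InA⇒Admissible n xs inA)
    ; to∘from   = λ { [] _ → refl
                    ; (zero ∷ cs) (_ , _ , tl) → cong (0 ∷_) (proj₂ (decode-correct cs Invariant-initial tl)) }
    }
    where
    to-pres : ∀ xs → length xs ≡ n → EveryLetter Admissible [] xs → CSeq n (toCSeq xs)
    to-pres []         len _             = len , tt
    to-pres (zero ∷ r) len ((_ , _) , rest) =
      trans (cong suc (length-encode initial r)) len , refl , proj₁ (encode-correct r Invariant-initial rest)

    from-pres : ∀ cs → CSeq n cs → InA-100-101 n (fromCSeq cs)
    from-pres []          (len , _)      = Admissible⇒InA n [] len tt
    from-pres (zero ∷ cs) (len , _ , tl) =
      Admissible⇒InA n (0 ∷ decode initial cs) (trans (cong suc (length-decode initial cs)) len)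
        ((refl , λ { (_ , inj₁ ()) ; (_ , inj₂ ()) }) , proj₁ (decode-correct cs Invariant-initial tl))

    from∘to : ∀ xs → EveryLetter Admissible [] xs → fromCSeq (toCSeq xs) ≡ xs
    from∘to []         _                = refl
    from∘to (zero ∷ r) ((_ , _) , rest) = cong (0 ∷_) (proj₂ (encode-correct r Invariant-initial rest))

module DyckPaths where

  open import Defs
  open Counting using (_≃_)
  open CSequences
  open import Data.Nat
  open import Data.Nat.Properties
  open import Data.Bool using (Bool; true; false; _∧_; _∨_)
  open import Data.Bool.Properties using (∨-conicalˡ; ∨-conicalʳ)
  open import Data.List using (List; []; _∷_; length; _++_; take)
  open import Data.Product using (_×_; _,_; proj₁)
  open import Data.Unit using (⊤; tt)
  open import Data.Empty using (⊥; ⊥-elim)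
  open import Relation.Binary.PropositionalEquality
  open ≡-Reasoning

  DyckFrom : ℕ → List Step → Set
  DyckFrom h       []      = h ≡ 0
  DyckFrom h       (U ∷ w) = DyckFrom (suc h) w
  DyckFrom zero    (D ∷ w) = ⊥
  DyckFrom (suc h) (D ∷ w) = DyckFrom h w

  length≡countU+countD : ∀ w → length w ≡ countU w + countD w
  length≡countU+countD []      = refl
  length≡countU+countD (U ∷ w) = cong suc (length≡countU+countD w)
  length≡countU+countD (D ∷ w) =
    trans (cong suc (length≡countU+countD w)) (sym (+-suc (countU w) (countD w)))

  ballot⇒DyckFrom : ∀ h w → (∀ k → countD (take k w) ≤ h + countU (take k w)) →
                    h + countU w ≡ countD w → DyckFrom h w
  ballot⇒DyckFrom h       []      _      balanced = trans (sym (+-identityʳ h)) balanced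
  ballot⇒DyckFrom h       (U ∷ w) ballot balanced =
    ballot⇒DyckFrom (suc h) w (λ k → subst (countD (take k w) ≤_) (+-suc h _) (ballot (suc k)))
                              (trans (sym (+-suc h _)) balanced)
  ballot⇒DyckFrom zero    (D ∷ w) ballot _ with ballot 1
  ... | ()
  ballot⇒DyckFrom (suc h) (D ∷ w) ballot balanced =
    ballot⇒DyckFrom h w (λ k → s≤s⁻¹ (ballot (suc k))) (suc-injective balanced)

  DyckFrom⇒ballot : ∀ h w → DyckFrom h w → ∀ k → countD (take k w) ≤ h + countU (take k w)
  DyckFrom⇒ballot h       w       _  zero    = z≤n
  DyckFrom⇒ballot h       []      _  (suc k) = z≤n
  DyckFrom⇒ballot h       (U ∷ w) dw (suc k) =
    subst (countD (take k w) ≤_) (sym (+-suc h _)) (DyckFrom⇒ballot (suc h) w dw k)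
  DyckFrom⇒ballot (suc h) (D ∷ w) dw (suc k) = s≤s (DyckFrom⇒ballot h w dw k)

  DyckFrom⇒balanced : ∀ h w → DyckFrom h w → h + countU w ≡ countD w
  DyckFrom⇒balanced h       []      dw = trans (+-identityʳ h) dw
  DyckFrom⇒balanced h       (U ∷ w) dw = trans (+-suc h _) (DyckFrom⇒balanced (suc h) w dw)
  DyckFrom⇒balanced (suc h) (D ∷ w) dw = cong suc (DyckFrom⇒balanced h w dw)

  IsDyck⇒DyckFrom : ∀ n w → IsDyck n w → DyckFrom 0 w
  IsDyck⇒DyckFrom n w (_ , #U , #D , ballot) = ballot⇒DyckFrom 0 w ballot (trans #U (sym #D))

  DyckFrom⇒IsDyck : ∀ w → DyckFrom 0 w → IsDyck (countU w) w
  DyckFrom⇒IsDyck w dw =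
    trans (length≡countU+countD w) (cong (countU w +_) #D) , refl , #D , DyckFrom⇒ballot 0 w dw
    where #D = sym (DyckFrom⇒balanced 0 w dw)

  descend : ℕ → List Step → List Step
  descend zero    w = w
  descend (suc k) w = D ∷ descend k w

  -- The path from height h to 0 whose up steps start at the heights cs.
  path : ℕ → List ℕ → List Step
  path h []       = descend h []
  path h (c ∷ cs) = descend (h ∸ c) (U ∷ path (suc c) cs)

  upHeights : ℕ → List Step → List ℕ
  upHeights h       []      = []
  upHeights h       (U ∷ w) = h ∷ upHeights (suc h) w
  upHeights zero    (D ∷ w) = []
  upHeights (suc h) (D ∷ w) = upHeights h w

  Reachable : ℕ → List ℕ → Set
  Reachable h []       = ⊤
  Reachable h (c ∷ cs) = c ≤ h × Reachable (suc c) cs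

  Reachable-suc : ∀ h cs → Reachable h cs → Reachable (suc h) cs
  Reachable-suc h []       _          = tt
  Reachable-suc h (c ∷ cs) (c≤h , rs) = m≤n⇒m≤1+n c≤h , rs

  Reachable-upHeights : ∀ h w → Reachable h (upHeights h w)
  Reachable-upHeights h       []      = tt
  Reachable-upHeights h       (U ∷ w) = ≤-refl , Reachable-upHeights (suc h) w
  Reachable-upHeights zero    (D ∷ w) = tt
  Reachable-upHeights (suc h) (D ∷ w) = Reachable-suc h _ (Reachable-upHeights h w)

  CTail⇒Reachable : ∀ p d cs → CTail p d cs → Reachable (suc p) cs
  CTail⇒Reachable p d     []       _            = tt
  CTail⇒Reachable p true  (c ∷ cs) (c≤p , tl)   = m≤n⇒m≤1+n c≤p , CTail⇒Reachable c _ cs tl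
  CTail⇒Reachable p false (c ∷ cs) (c≤1+p , tl) = c≤1+p , CTail⇒Reachable c _ cs tl

  DyckFrom-descend : ∀ k h w → DyckFrom h w → DyckFrom (k + h) (descend k w)
  DyckFrom-descend zero    h w dw = dw
  DyckFrom-descend (suc k) h w dw = DyckFrom-descend k h w dw

  DyckFrom-path : ∀ h cs → Reachable h cs → DyckFrom h (path h cs)
  DyckFrom-path h []       _          =
    subst (λ x → DyckFrom x (descend h [])) (+-identityʳ h) (DyckFrom-descend h 0 [] refl)
  DyckFrom-path h (c ∷ cs) (c≤h , rs) =
    subst (λ x → DyckFrom x (path h (c ∷ cs))) (m∸n+n≡m c≤h)
          (DyckFrom-descend (h ∸ c) c _ (DyckFrom-path (suc c) cs rs))

  countU-descend : ∀ k w → countU (descend k w) ≡ countU w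
  countU-descend zero    w = refl
  countU-descend (suc k) w = countU-descend k w

  countU-path : ∀ h cs → countU (path h cs) ≡ length cs
  countU-path h []       = countU-descend h []
  countU-path h (c ∷ cs) = trans (countU-descend (h ∸ c) _) (cong suc (countU-path (suc c) cs))

  upHeights-descend : ∀ k h w → upHeights (k + h) (descend k w) ≡ upHeights h w
  upHeights-descend zero    h w = refl
  upHeights-descend (suc k) h w = upHeights-descend k h w

  upHeights-path : ∀ h cs → Reachable h cs → upHeights h (path h cs) ≡ cs
  upHeights-path h []       _          =
    trans (cong (λ x → upHeights x (descend h [])) (sym (+-identityʳ h))) (upHeights-descend h 0 [])
  upHeights-path h (c ∷ cs) (c≤h , rs) = begin
    upHeights h (descend (h ∸ c) (U ∷ path (suc c) cs))
      ≡⟨ cong (λ x → upHeights x (descend (h ∸ c) _)) (sym (m∸n+n≡m c≤h)) ⟩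
    upHeights (h ∸ c + c) (descend (h ∸ c) (U ∷ path (suc c) cs))
      ≡⟨ upHeights-descend (h ∸ c) c _ ⟩
    c ∷ upHeights (suc c) (path (suc c) cs)
      ≡⟨ cong (c ∷_) (upHeights-path (suc c) cs rs) ⟩
    c ∷ cs ∎

  path-suc : ∀ h cs → Reachable h cs → path (suc h) cs ≡ D ∷ path h cs
  path-suc h []       _         = refl
  path-suc h (c ∷ cs) (c≤h , _) rewrite +-∸-assoc 1 c≤h = refl

  path-upHeights : ∀ h w → DyckFrom h w → path h (upHeights h w) ≡ w
  path-upHeights h       []      refl = refl
  path-upHeights h       (U ∷ w) dw   rewrite n∸n≡0 h = cong (U ∷_) (path-upHeights (suc h) w dw)
  path-upHeights (suc h) (D ∷ w) dw   =
    trans (path-suc h _ (Reachable-upHeights h w)) (cong (D ∷_) (path-upHeights h w dw))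

  length-upHeights : ∀ h w → DyckFrom h w → length (upHeights h w) ≡ countU w
  length-upHeights h       []      _  = refl
  length-upHeights h       (U ∷ w) dw = cong suc (length-upHeights (suc h) w dw)
  length-upHeights (suc h) (D ∷ w) dw = length-upHeights h w dw

  containsDDUU : List Step → Bool
  containsDDUU (D ∷ D ∷ U ∷ U ∷ w) = true
  containsDDUU []                  = false
  containsDDUU (_ ∷ w)             = containsDDUU w

  containsDDUU-++ : ∀ u v → containsDDUU (u ++ D ∷ D ∷ U ∷ U ∷ v) ≡ true
  containsDDUU-++ []                  v = refl
  containsDDUU-++ (U ∷ u)             v = containsDDUU-++ u v
  containsDDUU-++ (D ∷ [])            v = refl
  containsDDUU-++ (D ∷ U ∷ u)         v = containsDDUU-++ (U ∷ u) v
  containsDDUU-++ (D ∷ D ∷ [])        v = refl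
  containsDDUU-++ (D ∷ D ∷ D ∷ u)     v = containsDDUU-++ (D ∷ D ∷ u) v
  containsDDUU-++ (D ∷ D ∷ U ∷ [])    v = refl
  containsDDUU-++ (D ∷ D ∷ U ∷ U ∷ u) v = refl
  containsDDUU-++ (D ∷ D ∷ U ∷ D ∷ u) v = containsDDUU-++ (D ∷ u) v

  containsDDUU≡false⇒AvoidsDDUU : ∀ w → containsDDUU w ≡ false → AvoidsDDUU w
  containsDDUU≡false⇒AvoidsDDUU w free (u , v , refl) with () ← trans (sym free) (containsDDUU-++ u v)

  AvoidsDDUU⇒containsDDUU≡false : ∀ w → AvoidsDDUU w → containsDDUU w ≡ false
  AvoidsDDUU⇒containsDDUU≡false = go
    where
    drop1 : ∀ x w → AvoidsDDUU (x ∷ w) → AvoidsDDUU w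
    drop1 x w avoid (u , v , refl) = avoid (x ∷ u , v , refl)

    go : ∀ w → AvoidsDDUU w → containsDDUU w ≡ false
    go []                  _     = refl
    go (D ∷ D ∷ U ∷ U ∷ w) avoid = ⊥-elim (avoid ([] , w , refl))
    go (U ∷ w)             avoid = go w (drop1 U w avoid)
    go (D ∷ [])            _     = refl
    go (D ∷ U ∷ w)         avoid = go (U ∷ w) (drop1 D _ avoid)
    go (D ∷ D ∷ [])        _     = refl
    go (D ∷ D ∷ D ∷ w)     avoid = go (D ∷ D ∷ w) (drop1 D _ avoid)
    go (D ∷ D ∷ U ∷ [])    _     = refl
    go (D ∷ D ∷ U ∷ D ∷ w) avoid = go (D ∷ U ∷ D ∷ w) (drop1 D _ avoid)

  -- `DDUU-after d w`: w follows an up step, which itself followed DD exactly when d holds.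
  DDUU-after : Bool → List Step → Bool
  DDUU-after false w = containsDDUU (U ∷ w)
  DDUU-after true  w = containsDDUU (D ∷ D ∷ U ∷ w)

  containsDDUU-descend : ∀ k w → containsDDUU (descend k (U ∷ w)) ≡ DDUU-after (1 <ᵇ k) w
  containsDDUU-descend zero                w = refl
  containsDDUU-descend (suc zero)          w = refl
  containsDDUU-descend (suc (suc zero))    w = refl
  containsDDUU-descend (suc (suc (suc k))) w = containsDDUU-descend (suc (suc k)) w

  DDUU-after-descend : ∀ d k w →
                       DDUU-after d (descend k (U ∷ w)) ≡ (d ∧ (k ≡ᵇ 0)) ∨ DDUU-after (1 <ᵇ k) w
  DDUU-after-descend false k       w = containsDDUU-descend k w
  DDUU-after-descend true  zero    w = refl
  DDUU-after-descend true  (suc k) w = containsDDUU-descend (suc k) w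

  containsDDUU-descend-[] : ∀ k → containsDDUU (descend k []) ≡ false
  containsDDUU-descend-[] zero                = refl
  containsDDUU-descend-[] (suc zero)          = refl
  containsDDUU-descend-[] (suc (suc zero))    = refl
  containsDDUU-descend-[] (suc (suc (suc k))) = containsDDUU-descend-[] (suc (suc k))

  DDUU-after-descend-[] : ∀ d k → DDUU-after d (descend (suc k) []) ≡ false
  DDUU-after-descend-[] false k = containsDDUU-descend-[] (suc k)
  DDUU-after-descend-[] true  k = containsDDUU-descend-[] (suc k)

  two-downs⇔descent : ∀ p c → c ≤ suc p → (1 <ᵇ (suc p ∸ c)) ≡ (c <ᵇ p)
  two-downs⇔descent zero    zero          _         = refl
  two-downs⇔descent (suc p) zero          _         = refl
  two-downs⇔descent zero    (suc zero)    _         = refl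
  two-downs⇔descent zero    (suc (suc c)) (s≤s ())
  two-downs⇔descent (suc p) (suc c)       (s≤s c≤)  = two-downs⇔descent p c c≤

  ≤-bound⇒no-DDUU : ∀ p d c → c ≤ bound p d → (d ∧ (suc p ∸ c ≡ᵇ 0)) ≡ false
  ≤-bound⇒no-DDUU p       false c       _         = refl
  ≤-bound⇒no-DDUU p       true  zero    _         = refl
  ≤-bound⇒no-DDUU (suc p) true  (suc c) (s≤s c≤p) = ≤-bound⇒no-DDUU p true c c≤p

  no-DDUU⇒≤-bound : ∀ p d c → c ≤ suc p → (d ∧ (suc p ∸ c ≡ᵇ 0)) ≡ false → c ≤ bound p d
  no-DDUU⇒≤-bound p       false c             c≤1+p       _    = c≤1+p
  no-DDUU⇒≤-bound p       true  zero          _           _    = z≤n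
  no-DDUU⇒≤-bound zero    true  (suc zero)    _           ()
  no-DDUU⇒≤-bound zero    true  (suc (suc c)) (s≤s ())    _
  no-DDUU⇒≤-bound (suc p) true  (suc c)       (s≤s c≤1+p) free =
    s≤s (no-DDUU⇒≤-bound p true c c≤1+p free)

  CTail⇒DDUU-free : ∀ p d cs → CTail p d cs → DDUU-after d (path (suc p) cs) ≡ false
  CTail⇒DDUU-free p d []       _            = DDUU-after-descend-[] d p
  CTail⇒DDUU-free p d (c ∷ cs) (c≤b , tl) = begin
    DDUU-after d (descend (suc p ∸ c) (U ∷ path (suc c) cs))
      ≡⟨ DDUU-after-descend d (suc p ∸ c) _ ⟩
    (d ∧ (suc p ∸ c ≡ᵇ 0)) ∨ DDUU-after (1 <ᵇ (suc p ∸ c)) (path (suc c) cs)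
      ≡⟨ cong₂ _∨_ (≤-bound⇒no-DDUU p d c c≤b)
                   (cong (λ e → DDUU-after e (path (suc c) cs)) (two-downs⇔descent p c c≤1+p)) ⟩
    DDUU-after (c <ᵇ p) (path (suc c) cs)
      ≡⟨ CTail⇒DDUU-free c (c <ᵇ p) cs tl ⟩
    false ∎
    where c≤1+p = proj₁ (CTail⇒Reachable p d (c ∷ cs) (c≤b , tl))

  DDUU-free⇒CTail : ∀ p d cs → Reachable (suc p) cs →
                    DDUU-after d (path (suc p) cs) ≡ false → CTail p d cs
  DDUU-free⇒CTail p d []       _             _    = tt
  DDUU-free⇒CTail p d (c ∷ cs) (c≤1+p , rs) free =
    no-DDUU⇒≤-bound p d c c≤1+p (∨-conicalˡ _ _ free′) ,
    DDUU-free⇒CTail c (c <ᵇ p) cs rs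
      (subst (λ e → DDUU-after e (path (suc c) cs) ≡ false) (two-downs⇔descent p c c≤1+p)
             (∨-conicalʳ _ _ free′))
    where free′ = trans (sym (DDUU-after-descend d (suc p ∸ c) _)) free

  CSeq≃DyckDDUU : ∀ n → CSeq n ≃ InDyckDDUU n
  CSeq≃DyckDDUU n = record
    { to        = path 0
    ; from      = upHeights 0
    ; to-pres   = to-pres
    ; from-pres = from-pres
    ; from∘to   = λ cs (_ , c) → upHeights-path 0 cs (Reachable-CSeq cs c)
    ; to∘from   = λ w (dyck , _) → path-upHeights 0 w (IsDyck⇒DyckFrom n w dyck)
    }
    where
    Reachable-CSeq : ∀ cs → IsCSeq cs → Reachable 0 cs
    Reachable-CSeq []          _        = tt
    Reachable-CSeq (zero ∷ cs) (_ , tl) = z≤n , CTail⇒Reachable 0 false cs tl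

    to-pres : ∀ cs → CSeq n cs → InDyckDDUU n (path 0 cs)
    to-pres cs (refl , c) =
      subst (λ k → IsDyck k (path 0 cs)) (countU-path 0 cs)
            (DyckFrom⇒IsDyck _ (DyckFrom-path 0 cs (Reachable-CSeq cs c))) ,
      containsDDUU≡false⇒AvoidsDDUU _ (free cs c)
      where
      free : ∀ cs → IsCSeq cs → containsDDUU (path 0 cs) ≡ false
      free []          _        = refl
      free (zero ∷ cs) (_ , tl) = CTail⇒DDUU-free 0 false cs tl

    from-pres : ∀ w → InDyckDDUU n w → CSeq n (upHeights 0 w)
    from-pres w (dyck@(_ , #U , _) , avoid) =
      trans (length-upHeights 0 w dw) #U , shape w dw (AvoidsDDUU⇒containsDDUU≡false w avoid)
      where
      dw = IsDyck⇒DyckFrom n w dyck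
      shape : ∀ w → DyckFrom 0 w → containsDDUU w ≡ false → IsCSeq (upHeights 0 w)
      shape []      _  _    = tt
      shape (U ∷ w) dw free = refl , DDUU-free⇒CTail 0 false (upHeights 1 w) (Reachable-upHeights 1 w)
                                       (trans (cong (λ x → containsDDUU (U ∷ x)) (path-upHeights 1 w dw)) free)

module CSequenceCount where

  open Counting using (_≃_; ≃-trans; Card; Card-singleton; Card-⊎; Card-×; Card-Union<; Union<; ∑<; ∑<-cong)
  open CSequences
  open import Data.Nat
  open import Data.Nat.Properties
  open import Data.Nat.Induction using (<-rec)
  open import Data.Bool using (true; false)
  open import Data.List using (List; []; _∷_; length; _++_; map)
  open import Data.List.Properties using (length-++; length-map)
  open import Data.Product using (_×_; _,_; proj₁; proj₂)
  open import Data.Sum using (_⊎_; inj₁; inj₂; [_,_]′)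
  open import Data.Unit using (⊤; tt)
  open import Relation.Binary.PropositionalEquality
  open ≡-Reasoning

  StartsWith0 : List ℕ → Set
  StartsWith0 []      = ⊤
  StartsWith0 (c ∷ _) = c ≡ 0

  IsPaddedCSeq : List ℕ → Set
  IsPaddedCSeq []       = ⊤
  IsPaddedCSeq (c ∷ cs) = c ≡ 0 × IsCSeq cs

  PaddedCSeq : ℕ → List ℕ → Set
  PaddedCSeq k cs = length cs ≡ k × IsPaddedCSeq cs

  bound-suc : ∀ p d → bound (suc p) d ≡ suc (bound p d)
  bound-suc p true  = refl
  bound-suc p false = refl

  CTail-start⇒IsCSeq : ∀ cs → StartsWith0 cs → CTail 0 false cs → IsCSeq cs
  CTail-start⇒IsCSeq []          _ _        = tt
  CTail-start⇒IsCSeq (zero ∷ cs) _ (_ , tl) = refl , tl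

  IsCSeq⇒CTail-start : ∀ cs → IsCSeq cs → CTail 0 false cs
  IsCSeq⇒CTail-start []          _        = tt
  IsCSeq⇒CTail-start (zero ∷ cs) (_ , tl) = z≤n , tl

  CTail-after-descent⇒IsCSeq : ∀ cs → CTail 0 true cs → IsCSeq cs
  CTail-after-descent⇒IsCSeq []          _        = tt
  CTail-after-descent⇒IsCSeq (zero ∷ cs) (_ , tl) = refl , tl

  IsCSeq⇒CTail-after-descent : ∀ cs → IsCSeq cs → CTail 0 true cs
  IsCSeq⇒CTail-after-descent []          _        = tt
  IsCSeq⇒CTail-after-descent (zero ∷ cs) (_ , tl) = z≤n , tl

  IsPaddedCSeq⇒StartsWith0 : ∀ cs → IsPaddedCSeq cs → StartsWith0 cs
  IsPaddedCSeq⇒StartsWith0 []       _         = tt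
  IsPaddedCSeq⇒StartsWith0 (c ∷ cs) (c≡0 , _) = c≡0

  -- A return to 0 is a descent, after which 0 has to be repeated.
  CTail-lift⁻ : ∀ p d xs B → StartsWith0 B → CTail (suc p) d (map suc xs ++ B) →
                CTail p d xs × IsPaddedCSeq B
  CTail-lift⁻ p d []       []         _  _          = tt , tt
  CTail-lift⁻ p d []       (zero ∷ B) _  (_ , tl)   = tt , refl , CTail-after-descent⇒IsCSeq B tl
  CTail-lift⁻ p d (x ∷ xs) B          z  (x<b , tl) =
    (s≤s⁻¹ (subst (suc x ≤_) (bound-suc p d) x<b) , proj₁ rest) , proj₂ rest
    where rest = CTail-lift⁻ x (x <ᵇ p) xs B z tl

  CTail-lift : ∀ p d xs B → CTail p d xs → IsPaddedCSeq B → CTail (suc p) d (map suc xs ++ B)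
  CTail-lift p d []       []         _          _        = tt
  CTail-lift p d []       (zero ∷ B) _          (_ , c)  = z≤n , IsCSeq⇒CTail-after-descent B c
  CTail-lift p d (x ∷ xs) B          (x≤b , tl) padded =
    subst (suc x ≤_) (sym (bound-suc p d)) (s≤s x≤b) , CTail-lift x (x <ᵇ p) xs B tl padded

  splitPositive : List ℕ → List ℕ × List ℕ
  splitPositive []          = [] , []
  splitPositive (zero ∷ r)  = [] , zero ∷ r
  splitPositive (suc c ∷ r) = c ∷ proj₁ (splitPositive r) , proj₂ (splitPositive r)

  splitPositive-join : ∀ r → map suc (proj₁ (splitPositive r)) ++ proj₂ (splitPositive r) ≡ r
  splitPositive-join []          = refl
  splitPositive-join (zero ∷ r)  = refl
  splitPositive-join (suc c ∷ r) = cong (suc c ∷_) (splitPositive-join r)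

  splitPositive-StartsWith0 : ∀ r → StartsWith0 (proj₂ (splitPositive r))
  splitPositive-StartsWith0 []          = tt
  splitPositive-StartsWith0 (zero ∷ r)  = refl
  splitPositive-StartsWith0 (suc c ∷ r) = splitPositive-StartsWith0 r

  splitPositive-++ : ∀ A B → StartsWith0 B → splitPositive (map suc A ++ B) ≡ (A , B)
  splitPositive-++ []      []         _ = refl
  splitPositive-++ []      (zero ∷ B) _ = refl
  splitPositive-++ (a ∷ A) B          z rewrite splitPositive-++ A B z = refl

  Pieces : Set
  Pieces = List ℕ ⊎ (ℕ × (List ℕ × List ℕ))

  IsDecomposition : ℕ → Pieces → Set
  IsDecomposition n =
    [ CSeq n , Union< n (λ i (A , B) → CSeq (suc i) A × PaddedCSeq (n ∸ suc i) B) ]′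

  fromSplit : List ℕ × List ℕ → Pieces
  fromSplit ([]    , B) = inj₁ B
  fromSplit (a ∷ A , B) = inj₂ (length A , a ∷ A , B)

  decompose : List ℕ → Pieces
  decompose []      = inj₁ []
  decompose (_ ∷ r) = fromSplit (splitPositive r)

  recompose : Pieces → List ℕ
  recompose (inj₁ r)           = 0 ∷ r
  recompose (inj₂ (_ , A , B)) = 0 ∷ map suc A ++ B

  length-lift : ∀ A B → length (map suc A ++ B) ≡ length A + length B
  length-lift A B = trans (length-++ (map suc A)) (cong (_+ length B) (length-map suc A))

  -- Cut a c-sequence 0 r before the first return of r to 0.
  CSeq-decomposition : ∀ n → CSeq (suc n) ≃ IsDecomposition n
  CSeq-decomposition n = record
    { to        = decompose
    ; from      = recompose
    ; to-pres   = λ { (zero ∷ r) (len , _ , tl) → pieces-pres r (suc-injective len) tl }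
    ; from-pres = recompose-pres
    ; from∘to   = λ { (zero ∷ r) _ → recompose∘split r }
    ; to∘from   = decompose∘recompose
    }
    where
    pieces-pres : ∀ r → length r ≡ n → CTail 0 false r → IsDecomposition n (fromSplit (splitPositive r))
    pieces-pres r len tl with splitPositive r | splitPositive-join r | splitPositive-StartsWith0 r
    ... | []         , B | refl | z = len , CTail-start⇒IsCSeq B z tl
    ... | suc a ∷ A  , B | refl | z with s≤s () ← proj₁ tl
    ... | zero ∷ A   , B | refl | z =
      i<n , (refl , refl , proj₁ lifted) , #B , proj₂ lifted
      where
      lifted = CTail-lift⁻ 0 false A B z (proj₂ tl)
      len′ : suc (length A) + length B ≡ n
      len′ = trans (cong suc (sym (length-lift A B))) len
      i<n : length A < n
      i<n = subst (length A <_) len′ (s≤s (m≤m+n _ _))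
      #B : length B ≡ n ∸ suc (length A)
      #B = trans (sym (m+n∸m≡n (suc (length A)) (length B))) (cong (_∸ suc (length A)) len′)

    recompose-pres : ∀ t → IsDecomposition n t → CSeq (suc n) (recompose t)
    recompose-pres (inj₁ B) (len , c) = cong suc len , refl , IsCSeq⇒CTail-start B c
    recompose-pres (inj₂ (i , zero ∷ A , B)) (i<n , (#A , _ , tlA) , #B , padded) =
      cong suc (trans (length-lift (0 ∷ A) B) (trans (cong₂ _+_ #A #B) (m+[n∸m]≡n i<n))) ,
      refl , s≤s z≤n , CTail-lift 0 false A B tlA padded

    recompose∘split : ∀ r → recompose (fromSplit (splitPositive r)) ≡ 0 ∷ r
    recompose∘split r with splitPositive r | splitPositive-join r
    ... | []    , B | join = cong (0 ∷_) join
    ... | _ ∷ _ , B | join = cong (0 ∷_) join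

    decompose∘recompose : ∀ t → IsDecomposition n t → decompose (recompose t) ≡ t
    decompose∘recompose (inj₁ [])       _ = refl
    decompose∘recompose (inj₁ (zero ∷ B)) _ = refl
    decompose∘recompose (inj₂ (i , a ∷ A , B)) (_ , (#A , _) , _ , padded)
      rewrite splitPositive-++ A B (IsPaddedCSeq⇒StartsWith0 B padded) | suc-injective #A = refl

  padded : (ℕ → ℕ) → ℕ → ℕ
  padded a zero    = 1
  padded a (suc k) = a k

  step : (ℕ → ℕ) → ℕ → ℕ
  step a zero    = 1
  step a (suc n) = a n + (∑[ i < n ] a (suc i) * padded a (n ∸ suc i))

  step-local : ∀ n {a b : ℕ → ℕ} → (∀ j → j < n → a j ≡ b j) → step a n ≡ step b n
  step-local zero            a≡b = refl
  step-local (suc n) {a} {b} a≡b = cong₂ _+_ (a≡b n ≤-refl) (∑<-cong n term≡)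
    where
    padded≡ : ∀ k → k ≤ n → padded a k ≡ padded b k
    padded≡ zero    _   = refl
    padded≡ (suc k) k<n = a≡b k (m<n⇒m<1+n k<n)
    term≡ : ∀ i → i < n → a (suc i) * padded a (n ∸ suc i) ≡ b (suc i) * padded b (n ∸ suc i)
    term≡ i i<n = cong₂ _*_ (a≡b (suc i) (s≤s i<n)) (padded≡ (n ∸ suc i) (m∸n≤m n (suc i)))

  -- `approx k` agrees with the fixed point of `step` below k.
  approx : ℕ → ℕ → ℕ
  approx zero    = λ _ → 0
  approx (suc k) = step (approx k)

  approx-stable : ∀ k k′ n → n < k → n < k′ → approx k n ≡ approx k′ n
  approx-stable (suc k) (suc k′) n n<k n<k′ = step-local n (λ j j<n →
    approx-stable k k′ j (<-≤-trans j<n (s≤s⁻¹ n<k)) (<-≤-trans j<n (s≤s⁻¹ n<k′)))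

  count : ℕ → ℕ
  count n = approx (suc n) n

  count-step : ∀ n → count n ≡ step count n
  count-step n = step-local n (λ j j<n → approx-stable n (suc j) j j<n ≤-refl)

  Padded≃CSeq : ∀ k → PaddedCSeq (suc k) ≃ CSeq k
  Padded≃CSeq k = record
    { to        = λ { [] → [] ; (_ ∷ cs) → cs }
    ; from      = 0 ∷_
    ; to-pres   = λ { (_ ∷ cs) (len , _ , c) → suc-injective len , c }
    ; from-pres = λ cs (len , c) → cong suc len , refl , c
    ; from∘to   = λ { (zero ∷ cs) _ → refl }
    ; to∘from   = λ _ _ → refl
    }

  Card-Padded : ∀ k → (∀ j → j < k → Card (CSeq j) (count j)) → Card (PaddedCSeq k) (padded count k)
  Card-Padded zero    _     = Card-singleton [] (refl , tt) (λ { [] _ → refl })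
  Card-Padded (suc k) cards = ≃-trans (Padded≃CSeq k) (cards k ≤-refl)

  Card-CSeq : ∀ n → Card (CSeq n) (count n)
  Card-CSeq = <-rec (λ n → Card (CSeq n) (count n)) cardinality
    where
    cardinality : ∀ n → (∀ {m} → m < n → Card (CSeq m) (count m)) → Card (CSeq n) (count n)
    cardinality zero    _     = Card-singleton [] (refl , tt) (λ { [] _ → refl })
    cardinality (suc n) below =
      ≃-trans (CSeq-decomposition n) (subst (Card _) (sym (count-step (suc n)))
        (Card-⊎ (below ≤-refl) (Card-Union< _ n ([] , []) (λ i i<n →
          Card-× [] (below (s≤s i<n)) (Card-Padded (n ∸ suc i) (λ j j<k →
            below (<-≤-trans j<k (m≤n⇒m≤1+n (m∸n≤m n (suc i))))))))))

module GeneratingFunction where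

  open import Defs
  open Counting using (∑<; ∑<-cong)
  open CSequenceCount using (count; count-step; padded)
  open import Data.Nat as ℕ using (ℕ; zero; suc; _≤_; z≤n; s≤s)
  import Data.Nat.Properties as ℕ
  open import Data.Integer using (ℤ; +_; -_; _+_; _*_; _-_; 0ℤ)
  import Data.Integer.Properties as ℤ
  open import Data.Integer.Tactic.RingSolver using (solve-∀)
  open import Data.List using ([]; _∷_)
  open import Relation.Binary.PropositionalEquality
  open ≡-Reasoning

  sumTo-cong : ∀ n {f g : ℕ → ℤ} → (∀ i → i ≤ n → f i ≡ g i) → sumTo f n ≡ sumTo g n
  sumTo-cong zero    f≡g = f≡g 0 z≤n
  sumTo-cong (suc n) f≡g =
    cong₂ _+_ (sumTo-cong n (λ i i≤n → f≡g i (ℕ.m≤n⇒m≤1+n i≤n))) (f≡g (suc n) ℕ.≤-refl)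

  sumTo-peel : ∀ n (f : ℕ → ℤ) → sumTo f (suc n) ≡ f 0 + sumTo (λ i → f (suc i)) n
  sumTo-peel zero    f = refl
  sumTo-peel (suc n) f = trans (cong (_+ f (suc (suc n))) (sumTo-peel n f)) (ℤ.+-assoc (f 0) _ _)

  sumTo-zero : ∀ n → sumTo (λ _ → 0ℤ) n ≡ 0ℤ
  sumTo-zero zero    = refl
  sumTo-zero (suc n) = cong (_+ 0ℤ) (sumTo-zero n)

  sumTo-- : ∀ n (f g : ℕ → ℤ) → sumTo (λ i → f i - g i) n ≡ sumTo f n - sumTo g n
  sumTo-- zero    f g = refl
  sumTo-- (suc n) f g = trans (cong (_+ (f (suc n) - g (suc n))) (sumTo-- n f g))
                              (regroup (sumTo f n) (sumTo g n) (f (suc n)) (g (suc n)))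
    where
    regroup : ∀ a b c d → (a - b) + (c - d) ≡ (a + c) - (b + d)
    regroup = solve-∀

  sumTo-* : ∀ n c (f : ℕ → ℤ) → sumTo (λ i → c * f i) n ≡ c * sumTo f n
  sumTo-* zero    c f = refl
  sumTo-* (suc n) c f =
    trans (cong (_+ c * f (suc n)) (sumTo-* n c f)) (sym (ℤ.*-distribˡ-+ c (sumTo f n) (f (suc n))))

  sumTo-reverse : ∀ n (f : ℕ → ℤ) → sumTo f n ≡ sumTo (λ i → f (n ℕ.∸ i)) n
  sumTo-reverse zero    f = refl
  sumTo-reverse (suc n) f = begin
    sumTo f (suc n)
      ≡⟨ sumTo-peel n f ⟩
    f 0 + sumTo (λ i → f (suc i)) n
      ≡⟨ cong (_+_ (f 0)) (sumTo-reverse n (λ i → f (suc i))) ⟩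
    f 0 + sumTo (λ i → f (suc (n ℕ.∸ i))) n
      ≡⟨ cong (_+_ (f 0)) (sumTo-cong n (λ i i≤n → cong f (sym (ℕ.+-∸-assoc 1 i≤n)))) ⟩
    f 0 + sumTo (λ i → f (suc n ℕ.∸ i)) n
      ≡⟨ ℤ.+-comm (f 0) _ ⟩
    sumTo (λ i → f (suc n ℕ.∸ i)) n + f 0
      ≡⟨ cong (λ k → sumTo (λ i → f (suc n ℕ.∸ i)) n + f k) (sym (ℕ.n∸n≡0 n)) ⟩
    sumTo (λ i → f (suc n ℕ.∸ i)) (suc n) ∎

  ∸'≡∸ : ∀ m n → m ∸' n ≡ m ℕ.∸ n
  ∸'≡∸ m       zero    = refl
  ∸'≡∸ zero    (suc n) = refl
  ∸'≡∸ (suc m) (suc n) = ∸'≡∸ m n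

  ·-comm : ∀ f g n → (f · g) n ≡ (g · f) n
  ·-comm f g n = begin
    sumTo (λ i → f i * g (n ∸' i)) n               ≡⟨ sumTo-reverse n _ ⟩
    sumTo (λ i → f (n ℕ.∸ i) * g (n ∸' (n ℕ.∸ i))) n ≡⟨ sumTo-cong n swap ⟩
    sumTo (λ i → g i * f (n ∸' i)) n               ∎
    where
    swap : ∀ i → i ≤ n → f (n ℕ.∸ i) * g (n ∸' (n ℕ.∸ i)) ≡ g i * f (n ∸' i)
    swap i i≤n = begin
      f (n ℕ.∸ i) * g (n ∸' (n ℕ.∸ i))
        ≡⟨ cong₂ (λ j k → f j * g k) (sym (∸'≡∸ n i)) (trans (∸'≡∸ n (n ℕ.∸ i)) (ℕ.m∸[m∸n]≡n i≤n)) ⟩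
      f (n ∸' i) * g i
        ≡⟨ ℤ.*-comm (f (n ∸' i)) (g i) ⟩
      g i * f (n ∸' i) ∎

  ·-congˡ : ∀ {f f′} g → (∀ i → f i ≡ f′ i) → ∀ n → (f · g) n ≡ (f′ · g) n
  ·-congˡ g f≡f′ n = sumTo-cong n (λ i _ → cong (_* g (n ∸' i)) (f≡f′ i))

  ·-distribʳ-⊖ : ∀ f g h n → ((f ⊖ g) · h) n ≡ (f · h) n - (g · h) n
  ·-distribʳ-⊖ f g h n =
    trans (sumTo-cong n (λ i _ → distrib (f i) (g i) (h (n ∸' i)))) (sumTo-- n _ _)
    where
    distrib : ∀ a b c → (a - b) * c ≡ a * c - b * c
    distrib = solve-∀

  ·-scaleˡ : ∀ c f g n → ((λ i → c * f i) · g) n ≡ c * (f · g) n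
  ·-scaleˡ c f g n =
    trans (sumTo-cong n (λ i _ → ℤ.*-assoc c (f i) (g (n ∸' i)))) (sumTo-* n c (λ i → f i * g (n ∸' i)))

  ·-shiftˡ : ∀ f g n → f 0 ≡ 0ℤ → (f · g) (suc n) ≡ ((λ i → f (suc i)) · g) n
  ·-shiftˡ f g n f₀≡0 = begin
    (f · g) (suc n)                             ≡⟨ sumTo-peel n _ ⟩
    f 0 * g (suc n) + ((λ i → f (suc i)) · g) n ≡⟨ cong (λ x → x * g (suc n) + ((λ i → f (suc i)) · g) n) f₀≡0 ⟩
    0ℤ * g (suc n) + ((λ i → f (suc i)) · g) n  ≡⟨ ℤ.+-identityˡ _ ⟩
    ((λ i → f (suc i)) · g) n                   ∎

  poly-∷-· : ∀ c cs f n → (poly (c ∷ cs) · f) (suc n) ≡ c * f (suc n) + (poly cs · f) n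
  poly-∷-· c cs f n = sumTo-peel n _

  poly-[]-· : ∀ f n → (poly [] · f) n ≡ 0ℤ
  poly-[]-· f n = sumTo-zero n

  poly-[c]-· : ∀ c f n → (poly (c ∷ []) · f) n ≡ c * f n
  poly-[c]-· c f zero    = refl
  poly-[c]-· c f (suc n) =
    trans (poly-∷-· c [] f n) (trans (cong (_+_ (c * f (suc n))) (poly-[]-· f n)) (ℤ.+-identityʳ _))

  ·-shift²ˡ : ∀ f g n → f 0 ≡ 0ℤ → f 1 ≡ 0ℤ → (f · g) (suc (suc n)) ≡ ((λ i → f (suc (suc i))) · g) n
  ·-shift²ˡ f g n f₀≡0 f₁≡0 = trans (·-shiftˡ f g (suc n) f₀≡0) (·-shiftˡ (λ i → f (suc i)) g n f₁≡0)

  P₁ P₂ Δ : Series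
  P₁ = poly (+ 1 ∷ - (+ 2) ∷ + 1 ∷ [])
  P₂ = poly (+ 0 ∷ + 0 ∷ + 2 ∷ [])
  Δ  = poly (+ 1 ∷ - (+ 4) ∷ + 2 ∷ + 0 ∷ + 1 ∷ [])

  P₁-· : ∀ f m → (P₁ · f) (suc (suc m)) ≡ f (suc (suc m)) - + 2 * f (suc m) + f m
  P₁-· f m = begin
    (P₁ · f) (suc (suc m))
      ≡⟨ poly-∷-· _ _ f (suc m) ⟩
    + 1 * f (suc (suc m)) + (poly (- (+ 2) ∷ + 1 ∷ []) · f) (suc m)
      ≡⟨ cong (_+_ (+ 1 * f (suc (suc m)))) (poly-∷-· _ _ f m) ⟩
    + 1 * f (suc (suc m)) + (- (+ 2) * f (suc m) + (poly (+ 1 ∷ []) · f) m)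
      ≡⟨ cong (λ x → + 1 * f (suc (suc m)) + (- (+ 2) * f (suc m) + x)) (poly-[c]-· (+ 1) f m) ⟩
    + 1 * f (suc (suc m)) + (- (+ 2) * f (suc m) + + 1 * f m)
      ≡⟨ normalise (f (suc (suc m))) (f (suc m)) (f m) ⟩
    f (suc (suc m)) - + 2 * f (suc m) + f m ∎
    where
    normalise : ∀ a b c → + 1 * a + (- (+ 2) * b + + 1 * c) ≡ a - + 2 * b + c
    normalise = solve-∀

  F : Series
  F = ofℕ count

  convolution-tail : ℕ → ℕ
  convolution-tail m = ∑[ i < m ] count (suc i) ℕ.* count (m ℕ.∸ suc i)

  count-rec : ∀ m → count (suc (suc m)) ≡ count (suc m) ℕ.+ (convolution-tail m ℕ.+ count (suc m) ℕ.* 1)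
  count-rec m = trans (count-step (suc (suc m))) (cong (count (suc m) ℕ.+_) (cong₂ ℕ._+_
    (∑<-cong m (λ i i<m → cong (λ k → count (suc i) ℕ.* padded count k) (ℕ.+-∸-assoc 1 i<m)))
    (cong (λ k → count (suc m) ℕ.* padded count k) (ℕ.n∸n≡0 m))))

  +∑<≡sumTo : ∀ n (f : ℕ → ℕ) → + (∑< (suc n) f) ≡ sumTo (λ i → + f i) n
  +∑<≡sumTo zero    f = refl
  +∑<≡sumTo (suc n) f = trans (ℤ.pos-+ (∑< (suc n) f) (f (suc n))) (cong (_+ + f (suc n)) (+∑<≡sumTo n f))

  F·F≡F+tail : ∀ m → (F · F) m ≡ F m + + convolution-tail m
  F·F≡F+tail zero    = refl
  F·F≡F+tail (suc m) = begin
    (F · F) (suc m)                                          ≡⟨ sumTo-peel m _ ⟩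
    + 1 * F (suc m) + sumTo (λ i → F (suc i) * F (m ∸' i)) m ≡⟨ cong₂ _+_ (ℤ.*-identityˡ (F (suc m))) (sym tail) ⟩
    F (suc m) + + convolution-tail (suc m)                   ∎
    where
    tail : + convolution-tail (suc m) ≡ sumTo (λ i → F (suc i) * F (m ∸' i)) m
    tail = trans (+∑<≡sumTo m _) (sumTo-cong m (λ i _ →
             trans (ℤ.pos-* (count (suc i)) _) (cong (λ k → F (suc i) * + count k) (sym (∸'≡∸ m i)))))

  -- x²F² = (1 - x)²F - (1 - x), compared at x^{m+2}
  F·F≡P₁·F : ∀ m → (F · F) m ≡ (P₁ · F) (suc (suc m))
  F·F≡P₁·F m = begin
    (F · F) m
      ≡⟨ F·F≡F+tail m ⟩
    F m + + k
      ≡⟨ regroup (F m) (+ k) (F (suc m)) ⟩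
    (F (suc m) + (+ k + F (suc m) * + 1)) - + 2 * F (suc m) + F m
      ≡⟨ cong (λ x → x - + 2 * F (suc m) + F m) (sym F₂) ⟩
    F (suc (suc m)) - + 2 * F (suc m) + F m
      ≡⟨ sym (P₁-· F m) ⟩
    (P₁ · F) (suc (suc m)) ∎
    where
    k = convolution-tail m
    F₂ : F (suc (suc m)) ≡ F (suc m) + (+ k + F (suc m) * + 1)
    F₂ = trans (cong +_ (count-rec m)) (trans (ℤ.pos-+ (count (suc m)) _)
           (cong (_+_ (F (suc m))) (trans (ℤ.pos-+ k _) (cong (_+_ (+ k)) (ℤ.pos-* (count (suc m)) 1)))))
    regroup : ∀ x₀ t x₁ → x₀ + t ≡ (x₁ + (t + x₁ * + 1)) - + 2 * x₁ + x₀
    regroup = solve-∀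

  G : Series
  G = P₂ · F

  S : Series
  S = P₁ ⊖ G

  G-shift : ∀ i → G (suc (suc i)) ≡ + 2 * F i
  G-shift i = trans (·-shift²ˡ P₂ F i refl refl) (poly-[c]-· (+ 2) F i)

  G·G-shift : ∀ m → (G · G) (suc (suc (suc (suc m)))) ≡ + 4 * (F · F) m
  G·G-shift m = begin
    (G · G) (4 ℕ.+ m)                     ≡⟨ ·-shift²ˡ G G (suc (suc m)) refl refl ⟩
    (G₂ · G) (2 ℕ.+ m)                    ≡⟨ ·-comm G₂ G (suc (suc m)) ⟩
    (G · G₂) (2 ℕ.+ m)                    ≡⟨ ·-shift²ˡ G G₂ m refl refl ⟩
    (G₂ · G₂) m                           ≡⟨ ·-congˡ G₂ G-shift m ⟩
    (2F · G₂) m                           ≡⟨ ·-scaleˡ (+ 2) F G₂ m ⟩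
    + 2 * (F · G₂) m                      ≡⟨ cong (+ 2 *_) (·-comm F G₂ m) ⟩
    + 2 * (G₂ · F) m                      ≡⟨ cong (+ 2 *_) (·-congˡ F G-shift m) ⟩
    + 2 * (2F · F) m                      ≡⟨ cong (+ 2 *_) (·-scaleˡ (+ 2) F F m) ⟩
    + 2 * (+ 2 * (F · F) m)               ≡⟨ sym (ℤ.*-assoc (+ 2) (+ 2) _) ⟩
    + 4 * (F · F) m                       ∎
    where
    G₂ 2F : Series
    G₂ i = G (suc (suc i))
    2F i = + 2 * F i

  P₁·G-shift : ∀ m → (P₁ · G) (suc (suc (suc (suc m)))) ≡ + 2 * (P₁ · F) (suc (suc m))
  P₁·G-shift m = begin
    (P₁ · G) (4 ℕ.+ m)                          ≡⟨ ·-comm P₁ G (4 ℕ.+ m) ⟩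
    (G · P₁) (4 ℕ.+ m)                          ≡⟨ ·-shift²ˡ G P₁ (2 ℕ.+ m) refl refl ⟩
    ((λ i → G (suc (suc i))) · P₁) (2 ℕ.+ m)    ≡⟨ ·-congˡ P₁ G-shift (2 ℕ.+ m) ⟩
    ((λ i → + 2 * F i) · P₁) (2 ℕ.+ m)          ≡⟨ ·-scaleˡ (+ 2) F P₁ (2 ℕ.+ m) ⟩
    + 2 * (F · P₁) (2 ℕ.+ m)                    ≡⟨ cong (+ 2 *_) (·-comm F P₁ (2 ℕ.+ m)) ⟩
    + 2 * (P₁ · F) (2 ℕ.+ m)                    ∎

  P₁·P₁-shift : ∀ m → (P₁ · P₁) (suc (suc (suc (suc m)))) ≡ Δ (suc (suc (suc (suc m))))
  P₁·P₁-shift m = trans (P₁-· P₁ (suc (suc m))) (ℤ.+-identityˡ (P₁ (suc (suc m))))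

  S·S-expand : ∀ n → (S · S) n ≡ (P₁ · P₁) n - + 2 * (P₁ · G) n + (G · G) n
  S·S-expand n = begin
    (S · S) n
      ≡⟨ ·-distribʳ-⊖ P₁ G S n ⟩
    (P₁ · S) n - (G · S) n
      ≡⟨ cong₂ _-_ (·-comm P₁ S n) (·-comm G S n) ⟩
    (S · P₁) n - (S · G) n
      ≡⟨ cong₂ _-_ (·-distribʳ-⊖ P₁ G P₁ n) (·-distribʳ-⊖ P₁ G G n) ⟩
    ((P₁ · P₁) n - (G · P₁) n) - ((P₁ · G) n - (G · G) n)
      ≡⟨ cong (λ x → ((P₁ · P₁) n - x) - ((P₁ · G) n - (G · G) n)) (·-comm G P₁ n) ⟩
    ((P₁ · P₁) n - (P₁ · G) n) - ((P₁ · G) n - (G · G) n)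
      ≡⟨ regroup ((P₁ · P₁) n) ((P₁ · G) n) ((G · G) n) ⟩
    (P₁ · P₁) n - + 2 * (P₁ · G) n + (G · G) n ∎
    where
    regroup : ∀ a b c → (a - b) - (b - c) ≡ a - + 2 * b + c
    regroup = solve-∀

  S·S≡Δ : ∀ n → (S · S) n ≡ Δ n
  S·S≡Δ 0 = refl
  S·S≡Δ 1 = refl
  S·S≡Δ 2 = refl
  S·S≡Δ 3 = refl
  S·S≡Δ (suc (suc (suc (suc m)))) = begin
    (S · S) (4 ℕ.+ m)
      ≡⟨ S·S-expand (4 ℕ.+ m) ⟩
    (P₁ · P₁) (4 ℕ.+ m) - + 2 * (P₁ · G) (4 ℕ.+ m) + (G · G) (4 ℕ.+ m)
      ≡⟨ cong₂ (λ x y → (P₁ · P₁) (4 ℕ.+ m) - + 2 * x + y)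
               (P₁·G-shift m) (trans (G·G-shift m) (cong (+ 4 *_) (F·F≡P₁·F m))) ⟩
    (P₁ · P₁) (4 ℕ.+ m) - + 2 * (+ 2 * c) + + 4 * c
      ≡⟨ cancel ((P₁ · P₁) (4 ℕ.+ m)) c ⟩
    (P₁ · P₁) (4 ℕ.+ m)
      ≡⟨ P₁·P₁-shift m ⟩
    Δ (4 ℕ.+ m) ∎
    where
    c = (P₁ · F) (suc (suc m))
    cancel : ∀ a c → a - + 2 * (+ 2 * c) + + 4 * c ≡ a
    cancel = solve-∀

open import Defs
open import Data.Nat using (ℕ; _≥_)
open import Data.Integer using (+_; -_)
open import Data.List using (List; []; _∷_)
open import Data.Product using (Σ; _×_; _,_)
open import Relation.Binary.PropositionalEquality using (_≡_; refl)
open Counting using (≃-trans; ≃⇒SubsetBij; Card⇒HasCard)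
open ActiveLetters using (InA≃CSeq)
open DyckPaths using (CSeq≃DyckDDUU)
open CSequenceCount using (count; Card-CSeq)
open GeneratingFunction using (S·S≡Δ)

proposition3p1 : Σ (ℕ → ℕ) (λ a →
    (a 0 ≡ 1) ×
    ((n : ℕ) → n ≥ 1 → HasCard (InA-100-101 n) (a n)) ×
    (let S = poly (+ 1 ∷ - (+ 2) ∷ + 1 ∷ []) ⊖ (poly (+ 0 ∷ + 0 ∷ + 2 ∷ []) · ofℕ a)
    in ((n : ℕ) → (S · S) n ≡ poly (+ 1 ∷ - (+ 4) ∷ + 2 ∷ + 0 ∷ + 1 ∷ []) n) × (S 0 ≡ + 1)))
    × ((n : ℕ) → n ≥ 1 → SubsetBij (InA-100-101 n) (InDyckDDUU n))
proposition3p1 =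
  ( count
  , refl
  , (λ n _ → Card⇒HasCard (≃-trans (InA≃CSeq n) (Card-CSeq n)))
  , S·S≡Δ
  , refl )
  , λ n _ → ≃⇒SubsetBij (≃-trans (InA≃CSeq n) (CSeq≃DyckDDUU n))
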